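{- Let $t$ be a positive integer, let $C$ be an $\mathbb{F}_q$-$[n\times m,k]$ rank-metric code, let $\mathcal{M}=\mathcal{M}[C]$ and let $U\le E=\mathbb{F}_q^n$. Then \[ \bigl|\{(X_1,\ldots,X_t)\in C^t : \textstyle\sum_{i=1}^t \operatorname{supp}(X_i)=U\}\bigr| = \mathbb{P}(\mathcal{M}.U;q^{t}). \]
   Context: $q$ is a prime power, $E=\mathbb{F}_q^n$, and $\mathcal{L}(E)$ is the lattice of $\mathbb{F}_q$-subspaces of $E$; its Möbius function is $\mu(V,W)=(-1)^{d}q^{\binom{d}{2}}$ with $d=\dim W-\dim V$ if $V\le W$, and $0$ otherwise. For $U\le E$, $U^\perp$ is the orthogonal complement with respect to the standard dot product. An $\mathbb{F}_q$-$[n\times m,k]$ rank-metric code is a $k$-dimensional $\mathbb{F}_q$-subspace $C\subseteq\mathbb{F}_q^{n\times m}$. For $X\in\mathbb{F}_q^{n\times m}$, $\operatorname{supp}(X)$ is the column space of $X$ (a subspace of $\mathbb{F}_q^n$). For $U\le E$ set $C_U=\{X\in C:\operatorname{supp}(X)\le U^\perp\}$ and $\rho(U)=k-\dim_{\mathbb{F}_q}C_U$; $\mathcal{M}[C]=(\mathcal{L}(E),\rho)$. For $X\le Y$, $\mathcal{M}([X,Y])$ is the interval $[X,Y]$ with weight $T\mapsto\rho(T)-\rho(X)$, with characteristic polynomial $\mathbb{P}(\mathcal{M}([X,Y]);z)=\sum_{A\in[X,Y]}\mu(X,A)z^{\rho(Y)-\rho(A)}$. The contraction to $U$ is $\mathcal{M}.U=\mathcal{M}([U^\perp,E])$.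 -}

module Defs where

open import Data.Nat as ℕ using (ℕ; zero; suc; _∸_; _≤_)
open import Data.Nat.Combinatorics using (_C_)
open import Data.Integer as ℤ using (ℤ; +_)
open import Data.Bool using (Bool; true; false; _∧_; _∨_; not; if_then_else_; T)
open import Data.List as L using (List; []; _∷_; length)
open import Data.List.Membership.Propositional using (_∈_)
open import Data.List.Relation.Unary.Unique.Propositional using (Unique)
open import Data.Vec as V using (Vec; []; _∷_)
open import Data.Vec.Properties using (≡-dec)
open import Data.Product using (Σ; _×_; _,_)
open import Relation.Binary.PropositionalEquality using (_≡_; _≢_)
open import Relation.Binary.Definitions using (DecidableEquality)
open import Relation.Nullary.Decidable using (⌊_⌋)
open import Algebra.Structures using (IsCommutativeRing)

record FiniteField : Set₁ where
  field
    Carrier  : Set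
    _+_ _*_  : Carrier → Carrier → Carrier
    -_       : Carrier → Carrier
    0# 1#    : Carrier
    isCommutativeRing : IsCommutativeRing _≡_ _+_ _*_ -_ 0# 1#
    0≢1      : 0# ≢ 1#
    inverse  : ∀ x → x ≢ 0# → Σ Carrier (λ y → x * y ≡ 1#)
    _≟_      : DecidableEquality Carrier
    elements : List Carrier
    complete : ∀ x → x ∈ elements
    unique   : Unique elements

  order : ℕ
  order = length elements

allB : {A : Set} → (A → Bool) → List A → Bool
allB p []       = true
allB p (x ∷ xs) = p x ∧ allB p xs

anyB : {A : Set} → (A → Bool) → List A → Bool
anyB p []       = false
anyB p (x ∷ xs) = p x ∨ anyB p xs

countB : {A : Set} → (A → Bool) → List A → ℕ
countB p []       = 0
countB p (x ∷ xs) = (if p x then 1 else 0) ℕ.+ countB p xs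

sumℤ : {A : Set} → (A → ℤ) → List A → ℤ
sumℤ f []       = + 0
sumℤ f (x ∷ xs) = f x ℤ.+ sumℤ f xs

allVecsOf : {A : Set} → List A → (n : ℕ) → List (Vec A n)
allVecsOf xs zero    = [] ∷ []
allVecsOf xs (suc n) = L.concatMap (λ a → L.map (a ∷_) (allVecsOf xs n)) xs

-- all Boolean tables of length N (encoding subsets of an N-element list)
allTables : ℕ → List (List Bool)
allTables zero    = [] ∷ []
allTables (suc N) = L.concatMap (λ b → L.map (b ∷_) (allTables N)) (true ∷ false ∷ [])

memberOf : {A : Set} → (A → A → Bool) → List Bool → List A → A → Bool
memberOf eq (b ∷ bs) (w ∷ ws) v = if eq v w then b else memberOf eq bs ws v
memberOf eq _        _        v = false

module _ (F : FiniteField) where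
  open FiniteField F

  infix 4 _≟ᵇ_
  _≟ᵇ_ : Carrier → Carrier → Bool
  x ≟ᵇ y = ⌊ x ≟ y ⌋

  module LinAlg {V : Set} (0v : V) (_⊕_ : V → V → V) (_·_ : Carrier → V → V)
                (eqV : V → V → Bool) (allV : List V) where

    Sub : Set
    Sub = V → Bool

    _⊆ᵇ_ : Sub → Sub → Bool
    P ⊆ᵇ Q = allB (λ v → not (P v) ∨ Q v) allV

    _≗ᵇ_ : Sub → Sub → Bool
    P ≗ᵇ Q = (P ⊆ᵇ Q) ∧ (Q ⊆ᵇ P)

    isSubspace : Sub → Bool
    isSubspace P =
      P 0v
      ∧ allB (λ u → allB (λ w → not (P u ∧ P w) ∨ P (u ⊕ w)) allV) allV
      ∧ allB (λ a → allB (λ u → not (P u) ∨ P (a · u)) allV) elements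

    lincomb : ∀ {d} → Vec Carrier d → Vec V d → V
    lincomb []       []       = 0v
    lincomb (c ∷ cs) (b ∷ bs) = (c · b) ⊕ lincomb cs bs

    LinIndep : ∀ {d} → Vec V d → Set
    LinIndep {d} b = ∀ c → lincomb c b ≡ 0v → c ≡ V.replicate d 0#

    HasDim : Sub → ℕ → Set
    HasDim P d = Σ (Vec V d) λ b →
        (∀ i → T (P (V.lookup b i)))
      × LinIndep b
      × (∀ v → T (P v) → Σ (Vec Carrier d) λ c → lincomb c b ≡ v)

    allSubsets : List Sub
    allSubsets = L.map (λ t → memberOf eqV t allV) (allTables (length allV))

  vadd : ∀ {n} → Vec Carrier n → Vec Carrier n → Vec Carrier n
  vadd = V.zipWith _+_

  vscale : ∀ {n} → Carrier → Vec Carrier n → Vec Carrier n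
  vscale a = V.map (a *_)

  vzero : ∀ {n} → Vec Carrier n
  vzero = V.replicate _ 0#

  vneg : ∀ {n} → Vec Carrier n → Vec Carrier n
  vneg = V.map -_

  veq : ∀ {n} → Vec Carrier n → Vec Carrier n → Bool
  veq u v = ⌊ ≡-dec _≟_ u v ⌋

  dot : ∀ {n} → Vec Carrier n → Vec Carrier n → Carrier
  dot u v = V.foldr _ _+_ 0# (V.zipWith _*_ u v)

  allVecs : (n : ℕ) → List (Vec Carrier n)
  allVecs = allVecsOf elements

  module E (n : ℕ) = LinAlg {Vec Carrier n} vzero vadd vscale veq (allVecs n)

  whole : (n : ℕ) → E.Sub n
  whole n v = true

  zeroSub : (n : ℕ) → E.Sub n
  zeroSub n v = veq v vzero

  _⊥ : ∀ {n} → E.Sub n → E.Sub n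
  _⊥ {n} U v = allB (λ u → not (U u) ∨ (dot u v ≟ᵇ 0#)) (allVecs n)

  _⊞_ : ∀ {n} → E.Sub n → E.Sub n → E.Sub n
  _⊞_ {n} P Q v = anyB (λ u → P u ∧ Q (vadd v (vneg u))) (allVecs n)

  Mat : ℕ → ℕ → Set
  Mat n m = Vec (Vec Carrier m) n

  madd : ∀ {n m} → Mat n m → Mat n m → Mat n m
  madd = V.zipWith vadd

  mscale : ∀ {n m} → Carrier → Mat n m → Mat n m
  mscale a = V.map (vscale a)

  mzero : ∀ {n m} → Mat n m
  mzero = V.replicate _ vzero

  meq : ∀ {n m} → Mat n m → Mat n m → Bool
  meq X Y = ⌊ ≡-dec (≡-dec _≟_) X Y ⌋

  allMats : (n m : ℕ) → List (Mat n m)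
  allMats n m = allVecsOf (allVecs m) n

  module M (n m : ℕ) = LinAlg {Mat n m} mzero madd mscale meq (allMats n m)

  _·ᵥ_ : ∀ {n m} → Mat n m → Vec Carrier m → Vec Carrier n
  X ·ᵥ c = V.map (λ row → dot row c) X

  -- supp X = column space of X ≤ F^n
  supp : ∀ {n m} → Mat n m → E.Sub n
  supp {n} {m} X v = anyB (λ c → veq (X ·ᵥ c) v) (allVecs m)

  suppSum : ∀ {n m t} → Vec (Mat n m) t → E.Sub n
  suppSum {n} = V.foldr _ (λ X S → supp X ⊞ S) (zeroSub n)

  -- The q-matroid M[C] and its characteristic polynomial.
  -- dimE and dimM are dimension functions (their values on subspaces
  -- are pinned down by the hypotheses of the theorem, via HasDim).

  module QMatroid {n m k : ℕ} (Cd : M.Sub n m)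
                  (dimE : E.Sub n → ℕ) (dimM : M.Sub n m → ℕ) where

    C[_] : E.Sub n → M.Sub n m
    C[ U ] X = Cd X ∧ E._⊆ᵇ_ n (supp X) (U ⊥)

    ρ : E.Sub n → ℕ
    ρ U = k ∸ dimM C[ U ]

    μ : E.Sub n → E.Sub n → ℤ
    μ V W = if E._⊆ᵇ_ n V W
            then (let d = dimE W ∸ dimE V in
                  (ℤ.- (+ 1)) ℤ.^ d ℤ.* (+ (order ℕ.^ (d C 2))))
            else + 0

    -- weight of the interval minor M([X,Y]) : T ↦ ρ T − ρ X
    ρ[_] : E.Sub n → E.Sub n → ℕ
    ρ[ X ] T = ρ T ∸ ρ X

    charPoly : E.Sub n → E.Sub n → ℤ → ℤ
    charPoly X Y z =
      sumℤ (λ A → if E.isSubspace n A ∧ E._⊆ᵇ_ n X A ∧ E._⊆ᵇ_ n A Y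
                  then μ X A ℤ.* (z ℤ.^ (ρ[ X ] Y ∸ ρ[ X ] A))
                  else + 0)
           (E.allSubsets n)

    -- P(M.U ; z), M.U = M([U^⊥, E])
    charPolyContr : E.Sub n → ℤ → ℤ
    charPolyContr U z = charPoly (U ⊥) (whole n) z

{-# OPTIONS --safe #-}
module Submission where

-- C_A consists of the codewords supported in A^⊥, so (q^t)^(dim C_A) counts the
-- t-tuples of codewords whose support sum S satisfies A ≤ S^⊥.  Substituting this into
-- P(M.U; q^t) = Σ_{U^⊥ ≤ A} μ(U^⊥, A) (q^t)^(ρ(E) − ρ(A)), where ρ(E) − ρ(A) = dim C_A, and
-- exchanging the sums leaves, for every tuple, the Möbius sum Σ_{U^⊥ ≤ A ≤ S^⊥} μ(U^⊥, A), which is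
-- 1 if S^⊥ = U^⊥ and 0 otherwise; as S^⊥⊥ = S this selects exactly the tuples with S = U.
-- The Möbius sum over [X, Y] vanishes for X < Y by induction on dim Y: a hyperplane H ⊇ X not
-- containing Y splits [X, Y] into [X, Y ∩ H] and the subspaces A ⊈ H.  Grouped by B = A ∩ H, there
-- are q^(dim (Y ∩ H) − dim B) such A, each with μ(X, A) = −q^(dim B − dim X) μ(X, B), so the second
-- part is −q^(dim (Y ∩ H) − dim X) times the first, which by induction is 1 or 0 as Y ∩ H = X or not.
-- Dimensions enter only through the cardinalities |W| = q^(dim W).

open import Algebra.Core using (Op₂)
open import Algebra.Bundles using (Ring)
open import Algebra.Structures using (IsSemiring; IsCommutativeRing)
import Algebra.Properties.Ring as RingProperties
open import Data.Bool using (Bool; true; false; _∧_; _∨_; not; if_then_else_; T)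
import Data.Bool.Properties as BoolP
open import Data.Empty using (⊥-elim)
import Data.Fin as Fin
open import Data.Integer as ℤ using (ℤ; +_)
import Data.Integer.Properties as ℤP
open import Data.Integer.Solver using (module +-*-Solver)
open import Data.List using (List; []; _∷_; length; _++_; map; concatMap; cartesianProductWith)
import Data.List.Properties as ListP
open import Data.List.Membership.Propositional using (_∈_; _∉_)
open import Data.List.Membership.Propositional.Properties
  using (∈-cartesianProductWith⁺; ∈-cartesianProductWith⁻)
open import Data.List.Relation.Unary.All as All using (All)
import Data.List.Relation.Unary.AllPairs as AllPairs
open import Data.List.Relation.Unary.Any using (here; there)
open import Data.List.Relation.Unary.Unique.Propositional using (Unique)
import Data.List.Relation.Unary.Unique.Propositional.Properties as UniqueP
open import Data.Nat as ℕ using (ℕ; zero; suc; _≤_; _∸_; z≤n; s≤s)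
import Data.Nat.Properties as ℕP
open import Data.Nat.Combinatorics using (nCk+nC[k+1]≡[n+1]C[k+1]; nC1≡n) renaming (_C_ to _choose_)
open import Data.Product using (Σ; _×_; _,_; proj₁; proj₂)
open import Data.Unit using (tt)
open import Data.Vec as Vec using (Vec; toList)
import Data.Vec.Properties as VecP
open import Relation.Binary.PropositionalEquality
  using (_≡_; _≢_; refl; sym; trans; cong; cong₂; subst; subst₂; module ≡-Reasoning)
open import Relation.Binary.Definitions using (DecidableEquality)
open import Relation.Nullary using (Dec; yes; no; ¬_)
open import Relation.Nullary.Decidable using (⌊_⌋; toWitness; fromWitness)
open import Defs

T-∧⁺ : {a b : Bool} → T a → T b → T (a ∧ b)
T-∧⁺ {true} _ tb = tb

T-∧⁻ : {a b : Bool} → T (a ∧ b) → T a × T b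
T-∧⁻ {true} tb = tt , tb

T-not∨⁺ : {a b : Bool} → (T a → T b) → T (not a ∨ b)
T-not∨⁺ {true} f = f tt
T-not∨⁺ {false} f = tt

T-not∨⁻ : {a b : Bool} → T (not a ∨ b) → T a → T b
T-not∨⁻ {true} tb _ = tb

¬T-not∨⁻ : {a b : Bool} → ¬ T (not a ∨ b) → T a × ¬ T b
¬T-not∨⁻ {true} {false} _ = tt , λ ()
¬T-not∨⁻ {true} {true} n = ⊥-elim (n tt)
¬T-not∨⁻ {false} n = ⊥-elim (n tt)

T-not⁺ : {b : Bool} → ¬ T b → T (not b)
T-not⁺ {true} nb = nb tt
T-not⁺ {false} _ = tt

T-not⁻ : {b : Bool} → T (not b) → ¬ T b
T-not⁻ {false} _ ()

T-ext : {a b : Bool} → (T a → T b) → (T b → T a) → a ≡ b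
T-ext {true} {true} _ _ = refl
T-ext {true} {false} f _ = ⊥-elim (f tt)
T-ext {false} {true} _ g = ⊥-elim (g tt)
T-ext {false} {false} _ _ = refl

≡true⇒T : {b : Bool} → b ≡ true → T b
≡true⇒T refl = tt

T⇒≡true : {b : Bool} → T b → b ≡ true
T⇒≡true {true} _ = refl

≡false⇒¬T : {b : Bool} → b ≡ false → ¬ T b
≡false⇒¬T refl ()

⌊⌋-cong : {P Q : Set} (p? : Dec P) (q? : Dec Q) → (P → Q) → (Q → P) → ⌊ p? ⌋ ≡ ⌊ q? ⌋
⌊⌋-cong p? q? f g =
  T-ext (λ p → fromWitness {a? = q?} (f (toWitness p))) (λ q → fromWitness {a? = p?} (g (toWitness q)))

module _ {A : Set} (p : A → Bool) where

  allB⁺ : (xs : List A) → (∀ x → T (p x)) → T (allB p xs)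
  allB⁺ [] _ = tt
  allB⁺ (x ∷ xs) h = T-∧⁺ (h x) (allB⁺ xs h)

  allB⁻ : {xs : List A} → T (allB p xs) → ∀ {x} → x ∈ xs → T (p x)
  allB⁻ t (here refl) = proj₁ (T-∧⁻ t)
  allB⁻ {y ∷ _} t (there x∈xs) = allB⁻ (proj₂ (T-∧⁻ {p y} t)) x∈xs

  ¬allB⁻ : (xs : List A) → ¬ T (allB p xs) → Σ A (λ x → ¬ T (p x))
  ¬allB⁻ [] n = ⊥-elim (n tt)
  ¬allB⁻ (x ∷ xs) n with p x in eq
  ... | true = ¬allB⁻ xs n
  ... | false = x , ≡false⇒¬T eq

  anyB⁺ : {xs : List A} → ∀ {x} → x ∈ xs → T (p x) → T (anyB p xs)
  anyB⁺ {y ∷ _} (here refl) px with p y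
  ... | true = tt
  anyB⁺ {y ∷ _} (there x∈xs) px with p y
  ... | true = tt
  ... | false = anyB⁺ x∈xs px

  anyB⁻ : (xs : List A) → T (anyB p xs) → Σ A (λ x → T (p x))
  anyB⁻ (y ∷ xs) t with p y in eq
  ... | true = y , ≡true⇒T eq
  ... | false = anyB⁻ xs t

allB-∧ : {A : Set} (p r : A → Bool) (xs : List A) → allB (λ x → p x ∧ r x) xs ≡ allB p xs ∧ allB r xs
allB-∧ p r [] = refl
allB-∧ p r (x ∷ xs) with p x | r x
... | true | true = allB-∧ p r xs
... | true | false = sym (BoolP.∧-zeroʳ (allB p xs))
... | false | _ = refl

module ListSum {A : Set} {_+_ _*_ : Op₂ A} {0# 1# : A}
               (isS : IsSemiring _≡_ _+_ _*_ 0# 1#) where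
  open IsSemiring isS
    using (+-assoc; +-comm; +-identityˡ; +-identityʳ; zeroʳ; distribˡ)

  ∑ : {X : Set} → (X → A) → List X → A
  ∑ f [] = 0#
  ∑ f (x ∷ xs) = f x + ∑ f xs

  [_] : Bool → A
  [ b ] = if b then 1# else 0#

  module _ {X : Set} where

    ∑-cong : {f g : X → A} (xs : List X) → (∀ x → f x ≡ g x) → ∑ f xs ≡ ∑ g xs
    ∑-cong [] _ = refl
    ∑-cong (x ∷ xs) e = cong₂ _+_ (e x) (∑-cong xs e)

    ∑-cong-∈ : {f g : X → A} (xs : List X) → (∀ {x} → x ∈ xs → f x ≡ g x) → ∑ f xs ≡ ∑ g xs
    ∑-cong-∈ [] _ = refl
    ∑-cong-∈ (x ∷ xs) e = cong₂ _+_ (e (here refl)) (∑-cong-∈ xs (λ m → e (there m)))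

    ∑-zero : {f : X → A} (xs : List X) → (∀ x → f x ≡ 0#) → ∑ f xs ≡ 0#
    ∑-zero [] _ = refl
    ∑-zero (x ∷ xs) e = trans (cong₂ _+_ (e x) (∑-zero xs e)) (+-identityˡ 0#)

    ∑-+ : (f g : X → A) (xs : List X) → ∑ (λ x → f x + g x) xs ≡ ∑ f xs + ∑ g xs
    ∑-+ f g [] = sym (+-identityˡ 0#)
    ∑-+ f g (x ∷ xs) rewrite ∑-+ f g xs = interchange (f x) (g x) (∑ f xs) (∑ g xs)
      where
      interchange : ∀ a b c d → (a + b) + (c + d) ≡ (a + c) + (b + d)
      interchange a b c d = begin
        (a + b) + (c + d) ≡⟨ +-assoc a b (c + d) ⟩
        a + (b + (c + d)) ≡⟨ cong (_+_ a) (sym (+-assoc b c d)) ⟩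
        a + ((b + c) + d) ≡⟨ cong (λ z → a + (z + d)) (+-comm b c) ⟩
        a + ((c + b) + d) ≡⟨ cong (_+_ a) (+-assoc c b d) ⟩
        a + (c + (b + d)) ≡⟨ sym (+-assoc a c (b + d)) ⟩
        (a + c) + (b + d) ∎
        where open ≡-Reasoning

    ∑-*ˡ : (c : A) (f : X → A) (xs : List X) → ∑ (λ x → c * f x) xs ≡ c * ∑ f xs
    ∑-*ˡ c f [] = sym (zeroʳ c)
    ∑-*ˡ c f (x ∷ xs) rewrite ∑-*ˡ c f xs = sym (distribˡ c (f x) _)

    ∑-++ : (f : X → A) (xs ys : List X) → ∑ f (xs ++ ys) ≡ ∑ f xs + ∑ f ys
    ∑-++ f [] ys = sym (+-identityˡ _)
    ∑-++ f (x ∷ xs) ys rewrite ∑-++ f xs ys = sym (+-assoc (f x) _ _)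

    ∑-if : (b : Bool) (f : X → A) (xs : List X) →
           ∑ (λ x → if b then f x else 0#) xs ≡ (if b then ∑ f xs else 0#)
    ∑-if true f xs = refl
    ∑-if false f xs = ∑-zero xs (λ _ → refl)

  ∑-map : {X Y : Set} (f : Y → A) (g : X → Y) (xs : List X) → ∑ f (map g xs) ≡ ∑ (λ x → f (g x)) xs
  ∑-map f g [] = refl
  ∑-map f g (x ∷ xs) = cong (_+_ (f (g x))) (∑-map f g xs)

  ∑-concatMap : {X Y : Set} (f : Y → A) (g : X → List Y) (xs : List X) →
                ∑ f (concatMap g xs) ≡ ∑ (λ x → ∑ f (g x)) xs
  ∑-concatMap f g [] = refl
  ∑-concatMap f g (x ∷ xs) = trans (∑-++ f (g x) (concatMap g xs)) (cong (_+_ (∑ f (g x))) (∑-concatMap f g xs))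

  ∑-swap : {X Y : Set} (f : X → Y → A) (xs : List X) (ys : List Y) →
           ∑ (λ x → ∑ (f x) ys) xs ≡ ∑ (λ y → ∑ (λ x → f x y) xs) ys
  ∑-swap f [] ys = sym (∑-zero ys (λ _ → refl))
  ∑-swap f (x ∷ xs) ys rewrite ∑-swap f xs ys = sym (∑-+ (f x) (λ y → ∑ (λ x′ → f x′ y) xs) ys)

  if-∧-split : (g h : Bool) (a : A) →
               (if g then a else 0#) ≡ (if g ∧ h then a else 0#) + (if g ∧ not h then a else 0#)
  if-∧-split true true a = sym (+-identityʳ a)
  if-∧-split true false a = sym (+-identityˡ a)
  if-∧-split false h a = sym (+-identityˡ 0#)

  if-then-*ˡ : (b : Bool) (c a : A) → (if b then c * a else 0#) ≡ c * (if b then a else 0#)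
  if-then-*ˡ true c a = refl
  if-then-*ˡ false c a = sym (zeroʳ c)

  if-if≡if-∧ : (g h : Bool) (a : A) → (if g then (if h then a else 0#) else 0#) ≡ (if g ∧ h then a else 0#)
  if-if≡if-∧ true h a = refl
  if-if≡if-∧ false h a = refl

  module _ {X : Set} (_≟_ : DecidableEquality X) where

    ∑-δ-∉ : (f : X → A) {xs : List X} {b : X} → b ∉ xs → ∑ (λ y → if ⌊ y ≟ b ⌋ then f y else 0#) xs ≡ 0#
    ∑-δ-∉ f {xs} {b} b∉xs = trans (∑-cong-∈ xs vanish) (∑-zero xs (λ _ → refl))
      where
      vanish : ∀ {y} → y ∈ xs → (if ⌊ y ≟ b ⌋ then f y else 0#) ≡ 0#
      vanish {y} y∈xs with y ≟ b
      ... | yes refl = ⊥-elim (b∉xs y∈xs)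
      ... | no _ = refl

    ∑-δ : (f : X → A) {xs : List X} → Unique xs → ∀ {b} → b ∈ xs →
          ∑ (λ y → if ⌊ y ≟ b ⌋ then f y else 0#) xs ≡ f b
    ∑-δ f {y ∷ ys} (y∉ys AllPairs.∷ u) {b} b∈xs with y ≟ b
    ∑-δ f (y∉ys AllPairs.∷ u) (here refl) | yes refl =
      trans (cong (_+_ (f _)) (∑-δ-∉ f (λ m → All.lookup y∉ys m refl))) (+-identityʳ _)
    ∑-δ f (y∉ys AllPairs.∷ u) (there b∈ys) | yes refl = ⊥-elim (All.lookup y∉ys b∈ys refl)
    ∑-δ f (y∉ys AllPairs.∷ u) (here refl) | no y≢b = ⊥-elim (y≢b refl)
    ∑-δ f (y∉ys AllPairs.∷ u) (there b∈ys) | no _ = trans (+-identityˡ _) (∑-δ f u b∈ys)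

module ℕ∑ = ListSum ℕP.+-*-isSemiring
module ℤ∑ = ListSum ℤP.+-*-isSemiring

count : {X : Set} → (X → Bool) → List X → ℕ
count p = ℕ∑.∑ (λ x → ℕ∑.[ p x ])

countB≡count : {X : Set} (p : X → Bool) (xs : List X) → countB p xs ≡ count p xs
countB≡count p [] = refl
countB≡count p (x ∷ xs) = cong (ℕ∑.[ p x ] ℕ.+_) (countB≡count p xs)

sumℤ≡∑ : {X : Set} (f : X → ℤ) (xs : List X) → sumℤ f xs ≡ ℤ∑.∑ f xs
sumℤ≡∑ f [] = refl
sumℤ≡∑ f (x ∷ xs) = cong (ℤ._+_ (f x)) (sumℤ≡∑ f xs)

+-∑ : {X : Set} (f : X → ℕ) (xs : List X) → + ℕ∑.∑ f xs ≡ ℤ∑.∑ (λ x → + f x) xs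
+-∑ f [] = refl
+-∑ f (x ∷ xs) = trans (ℤP.pos-+ (f x) (ℕ∑.∑ f xs)) (cong (ℤ._+_ (+ f x)) (+-∑ f xs))

+-^ : (a b : ℕ) → (+ a) ℤ.^ b ≡ + (a ℕ.^ b)
+-^ a zero = refl
+-^ a (suc b) = trans (cong (ℤ._*_ (+ a)) (+-^ a b)) (sym (ℤP.pos-* a (a ℕ.^ b)))

+-[] : (b : Bool) → + ℕ∑.[ b ] ≡ ℤ∑.[ b ]
+-[] true = refl
+-[] false = refl

∑-const : {X : Set} (k : ℕ) (xs : List X) → ℕ∑.∑ (λ _ → k) xs ≡ length xs ℕ.* k
∑-const k [] = refl
∑-const k (x ∷ xs) = cong (k ℕ.+_) (∑-const k xs)

count-mono : {X : Set} (p r : X → Bool) (xs : List X) → (∀ x → T (p x) → T (r x)) → count p xs ≤ count r xs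
count-mono p r [] _ = z≤n
count-mono p r (x ∷ xs) h = ℕP.+-mono-≤ (indicator-mono (h x)) (count-mono p r xs h)
  where
  indicator-mono : {a b : Bool} → (T a → T b) → ℕ∑.[ a ] ≤ ℕ∑.[ b ]
  indicator-mono {false} _ = z≤n
  indicator-mono {true} {true} _ = s≤s z≤n
  indicator-mono {true} {false} f = ⊥-elim (f tt)

record IsEnumeration {A : Set} (xs : List A) : Set where
  field
    ∈-complete : ∀ x → x ∈ xs
    unique : Unique xs

count-≟ : {A : Set} (_≟_ : DecidableEquality A) {xs : List A} → IsEnumeration xs →
          ∀ b → count (λ y → ⌊ y ≟ b ⌋) xs ≡ 1
count-≟ _≟_ en b = ℕ∑.∑-δ _≟_ (λ _ → 1) (IsEnumeration.unique en) (IsEnumeration.∈-complete en b)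

count-bijection : {A B : Set} (_≟A_ : DecidableEquality A) (_≟B_ : DecidableEquality B)
  {xs : List A} {ys : List B} → IsEnumeration xs → IsEnumeration ys →
  (f : A → B) (g : B → A) → (∀ x → g (f x) ≡ x) → (∀ y → f (g y) ≡ y) →
  (p : A → Bool) (r : B → Bool) → (∀ x → p x ≡ r (f x)) → count p xs ≡ count r ys
count-bijection _≟A_ _≟B_ {xs} {ys} enA enB f g gf fg p r pr = begin
  count p xs
    ≡⟨ ℕ∑.∑-cong xs (λ x → sym (δ _≟B_ enB (λ _ → ℕ∑.[ p x ]) (f x))) ⟩
  ℕ∑.∑ (λ x → ℕ∑.∑ (λ y → if ⌊ y ≟B f x ⌋ then ℕ∑.[ p x ] else 0) ys) xs
    ≡⟨ ℕ∑.∑-swap _ xs ys ⟩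
  ℕ∑.∑ (λ y → ℕ∑.∑ (λ x → if ⌊ y ≟B f x ⌋ then ℕ∑.[ p x ] else 0) xs) ys
    ≡⟨ ℕ∑.∑-cong ys (λ y → ℕ∑.∑-cong xs (transpose y)) ⟩
  ℕ∑.∑ (λ y → ℕ∑.∑ (λ x → if ⌊ x ≟A g y ⌋ then ℕ∑.[ r y ] else 0) xs) ys
    ≡⟨ ℕ∑.∑-cong ys (λ y → δ _≟A_ enA (λ _ → ℕ∑.[ r y ]) (g y)) ⟩
  count r ys ∎
  where
  open ≡-Reasoning
  δ : {C : Set} (_≟_ : DecidableEquality C) {zs : List C} → IsEnumeration zs → (h : C → ℕ) (c : C) →
      ℕ∑.∑ (λ z → if ⌊ z ≟ c ⌋ then h z else 0) zs ≡ h c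
  δ _≟_ en h c = ℕ∑.∑-δ _≟_ h (IsEnumeration.unique en) (IsEnumeration.∈-complete en c)
  transpose : ∀ y x → (if ⌊ y ≟B f x ⌋ then ℕ∑.[ p x ] else 0) ≡ (if ⌊ x ≟A g y ⌋ then ℕ∑.[ r y ] else 0)
  transpose y x with y ≟B f x | x ≟A g y
  ... | yes refl | yes _ = cong ℕ∑.[_] (pr x)
  ... | yes refl | no x≢gfx = ⊥-elim (x≢gfx (sym (gf x)))
  ... | no y≢fgy | yes refl = ⊥-elim (y≢fgy (sym (fg y)))
  ... | no _ | no _ = refl

concatMap-map≡cartesianProductWith : {A B C : Set} (f : A → B → C) (xs : List A) (ys : List B) →
  concatMap (λ x → map (f x) ys) xs ≡ cartesianProductWith f xs ys
concatMap-map≡cartesianProductWith f [] ys = refl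
concatMap-map≡cartesianProductWith f (x ∷ xs) ys =
  cong (map (f x) ys ++_) (concatMap-map≡cartesianProductWith f xs ys)

allVecsOf-isEnumeration : {A : Set} {xs : List A} → IsEnumeration xs → ∀ n → IsEnumeration (allVecsOf xs n)
allVecsOf-isEnumeration {A} {xs} en n = record { ∈-complete = complete n ; unique = unique n }
  where
  open IsEnumeration en renaming (∈-complete to ∈xs; unique to uniquexs)
  complete : ∀ n (v : Vec A n) → v ∈ allVecsOf xs n
  complete zero Vec.[] = here refl
  complete (suc n) (x Vec.∷ v) =
    subst ((x Vec.∷ v) ∈_) (sym (concatMap-map≡cartesianProductWith Vec._∷_ xs (allVecsOf xs n)))
      (∈-cartesianProductWith⁺ Vec._∷_ (∈xs x) (complete n v))
  unique : ∀ n → Unique (allVecsOf xs n)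
  unique zero = All.[] AllPairs.∷ AllPairs.[]
  unique (suc n) =
    subst Unique (sym (concatMap-map≡cartesianProductWith Vec._∷_ xs (allVecsOf xs n)))
      (UniqueP.cartesianProductWith⁺ Vec._∷_ VecP.∷-injective uniquexs (unique n))

allTables-unique : ∀ N → Unique (allTables N)
allTables-unique zero = All.[] AllPairs.∷ AllPairs.[]
allTables-unique (suc N) =
  subst Unique (sym (concatMap-map≡cartesianProductWith _∷_ (true ∷ false ∷ []) (allTables N)))
    (UniqueP.cartesianProductWith⁺ _∷_ ListP.∷-injective booleans-unique (allTables-unique N))
  where
  booleans-unique : Unique (true ∷ false ∷ [])
  booleans-unique = ((λ ()) All.∷ All.[]) AllPairs.∷ (All.[] AllPairs.∷ AllPairs.[])

∈-allTables : (t : List Bool) → t ∈ allTables (length t)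
∈-allTables [] = here refl
∈-allTables (b ∷ t) =
  subst ((b ∷ t) ∈_) (sym (concatMap-map≡cartesianProductWith _∷_ (true ∷ false ∷ []) (allTables (length t))))
    (∈-cartesianProductWith⁺ _∷_ (∈-booleans b) (∈-allTables t))
  where
  ∈-booleans : ∀ b → b ∈ true ∷ false ∷ []
  ∈-booleans true = here refl
  ∈-booleans false = there (here refl)

allTables-length : ∀ N {t} → t ∈ allTables N → length t ≡ N
allTables-length zero (here refl) = refl
allTables-length (suc N) {t} t∈ with ∈-cartesianProductWith⁻ _∷_ (true ∷ false ∷ []) (allTables N)
  (subst (t ∈_) (concatMap-map≡cartesianProductWith _∷_ (true ∷ false ∷ []) (allTables N)) t∈)
... | _ , t′ , _ , t′∈ , refl = cong suc (allTables-length N t′∈)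

module _ {A : Set} (_≟_ : DecidableEquality A) where

  private
    eqᵇ : A → A → Bool
    eqᵇ x y = ⌊ x ≟ y ⌋

  memberOf-map : (P : A → Bool) (ws : List A) {v : A} → v ∈ ws → memberOf eqᵇ (map P ws) ws v ≡ P v
  memberOf-map P (w ∷ ws) {v} v∈ with v ≟ w
  ... | yes refl = refl
  memberOf-map P (w ∷ ws) (here refl) | no v≢w = ⊥-elim (v≢w refl)
  memberOf-map P (w ∷ ws) (there v∈ws) | no _ = memberOf-map P ws v∈ws

  memberOf⇒≡map : (P : A → Bool) {ws : List A} → Unique ws → (t : List Bool) → length t ≡ length ws →
                  (∀ {v} → v ∈ ws → memberOf eqᵇ t ws v ≡ P v) → t ≡ map P ws
  memberOf⇒≡map P {[]} _ [] _ _ = refl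
  memberOf⇒≡map P {w ∷ ws} (w∉ws AllPairs.∷ u) (b ∷ bs) len h =
    cong₂ _∷_ head-entry (memberOf⇒≡map P u bs (ℕP.suc-injective len) tail-entries)
    where
    head-entry : b ≡ P w
    head-entry with w ≟ w | h (here refl)
    ... | yes _ | e = e
    ... | no w≢w | _ = ⊥-elim (w≢w refl)
    tail-entries : ∀ {v} → v ∈ ws → memberOf eqᵇ bs ws v ≡ P v
    tail-entries {v} v∈ws with v ≟ w | h (there v∈ws)
    ... | yes refl | _ = ⊥-elim (All.lookup w∉ws v∈ws refl)
    ... | no _ | e = e

∑-allVecsOf-1 : {A : Set} (xs : List A) (n : ℕ) → ℕ∑.∑ (λ _ → 1) (allVecsOf xs n) ≡ length xs ℕ.^ n
∑-allVecsOf-1 xs zero = refl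
∑-allVecsOf-1 xs (suc n) = begin
  ℕ∑.∑ (λ _ → 1) (concatMap (λ x → map (x Vec.∷_) (allVecsOf xs n)) xs)
    ≡⟨ ℕ∑.∑-concatMap _ _ xs ⟩
  ℕ∑.∑ (λ x → ℕ∑.∑ (λ _ → 1) (map (x Vec.∷_) (allVecsOf xs n))) xs
    ≡⟨ ℕ∑.∑-cong xs (λ x → trans (ℕ∑.∑-map _ _ (allVecsOf xs n)) (∑-allVecsOf-1 xs n)) ⟩
  ℕ∑.∑ (λ _ → length xs ℕ.^ n) xs
    ≡⟨ ∑-const _ xs ⟩
  length xs ℕ.^ suc n ∎
  where open ≡-Reasoning

count-allVecsOf : {A : Set} (p : A → Bool) (xs : List A) (n : ℕ) →
  count (λ v → allB p (toList v)) (allVecsOf xs n) ≡ count p xs ℕ.^ n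
count-allVecsOf p xs zero = refl
count-allVecsOf p xs (suc n) = begin
  count (λ v → allB p (toList v)) (concatMap (λ x → map (x Vec.∷_) (allVecsOf xs n)) xs)
    ≡⟨ ℕ∑.∑-concatMap _ _ xs ⟩
  ℕ∑.∑ (λ x → count (λ v → allB p (toList v)) (map (x Vec.∷_) (allVecsOf xs n))) xs
    ≡⟨ ℕ∑.∑-cong xs (λ x → trans (ℕ∑.∑-map _ _ (allVecsOf xs n))
                      (trans (ℕ∑.∑-cong (allVecsOf xs n) (λ v → []-∧ (p x) _))
                             (ℕ∑.∑-*ˡ ℕ∑.[ p x ] _ (allVecsOf xs n)))) ⟩
  ℕ∑.∑ (λ x → ℕ∑.[ p x ] ℕ.* count (λ v → allB p (toList v)) (allVecsOf xs n)) xs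
    ≡⟨ ℕ∑.∑-cong xs (λ x → trans (cong (ℕ∑.[ p x ] ℕ.*_) (count-allVecsOf p xs n)) (ℕP.*-comm ℕ∑.[ p x ] _)) ⟩
  ℕ∑.∑ (λ x → count p xs ℕ.^ n ℕ.* ℕ∑.[ p x ]) xs
    ≡⟨ ℕ∑.∑-*ˡ (count p xs ℕ.^ n) _ xs ⟩
  count p xs ℕ.^ n ℕ.* count p xs
    ≡⟨ ℕP.*-comm (count p xs ℕ.^ n) (count p xs) ⟩
  count p xs ℕ.^ suc n ∎
  where
  open ≡-Reasoning
  []-∧ : (a b : Bool) → ℕ∑.[ a ∧ b ] ≡ ℕ∑.[ a ] ℕ.* ℕ∑.[ b ]
  []-∧ true b = sym (ℕP.+-identityʳ ℕ∑.[ b ])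
  []-∧ false b = refl

module FieldFacts (F : FiniteField) where
  open FiniteField F public
  module R = IsCommutativeRing isCommutativeRing

  RingF : Ring _ _
  RingF = record { isRing = R.isRing }

  module RingF = RingProperties RingF

  q : ℕ
  q = order

  elements-isEnumeration : IsEnumeration elements
  elements-isEnumeration = record { ∈-complete = complete ; unique = unique }

  q≥2 : 2 ≤ q
  q≥2 = begin
    2
      ≡⟨ cong₂ ℕ._+_ (sym (count-≟ _≟_ elements-isEnumeration 0#)) (sym (count-≟ _≟_ elements-isEnumeration 1#)) ⟩
    count (λ y → ⌊ y ≟ 0# ⌋) elements ℕ.+ count (λ y → ⌊ y ≟ 1# ⌋) elements
      ≡⟨ sym (ℕ∑.∑-+ _ _ elements) ⟩
    ℕ∑.∑ (λ y → ℕ∑.[ ⌊ y ≟ 0# ⌋ ] ℕ.+ ℕ∑.[ ⌊ y ≟ 1# ⌋ ]) elements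
      ≤⟨ at-most-one elements ⟩
    ℕ∑.∑ (λ _ → 1) elements
      ≡⟨ trans (∑-const 1 elements) (ℕP.*-identityʳ _) ⟩
    q ∎
    where
    open ℕP.≤-Reasoning
    at-most-one : ∀ xs → ℕ∑.∑ (λ y → ℕ∑.[ ⌊ y ≟ 0# ⌋ ] ℕ.+ ℕ∑.[ ⌊ y ≟ 1# ⌋ ]) xs
                       ≤ ℕ∑.∑ (λ _ → 1) xs
    at-most-one [] = z≤n
    at-most-one (y ∷ xs) = ℕP.+-mono-≤ (pointwise y) (at-most-one xs)
      where
      pointwise : ∀ y → ℕ∑.[ ⌊ y ≟ 0# ⌋ ] ℕ.+ ℕ∑.[ ⌊ y ≟ 1# ⌋ ] ≤ 1
      pointwise y with y ≟ 0# | y ≟ 1#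
      ... | yes refl | yes 0≡1 = ⊥-elim (0≢1 0≡1)
      ... | yes _ | no _ = s≤s z≤n
      ... | no _ | yes _ = s≤s z≤n
      ... | no _ | no _ = z≤n

  -1*≡- : ∀ a → (- 1#) * a ≡ - a
  -1*≡- = RingF.-1*x≈-x

  x+-1*x≡0 : ∀ a → a + ((- 1#) * a) ≡ 0#
  x+-1*x≡0 a = trans (cong (_+_ a) (-1*≡- a)) (R.-‿inverseʳ a)

  x*-y+z≡z+-1*[x*y] : ∀ c d e → (c * (- d)) + e ≡ e + ((- 1#) * (c * d))
  x*-y+z≡z+-1*[x*y] c d e =
    trans (cong (_+ e) (trans (sym (RingF.-‿distribʳ-* c d)) (sym (-1*≡- (c * d))))) (R.+-comm _ e)

  record VectorSpaceLaws {V : Set} (0v : V) (_⊕_ : V → V → V) (_·_ : Carrier → V → V) : Set where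
    field
      ⊕-assoc : ∀ x y z → (x ⊕ y) ⊕ z ≡ x ⊕ (y ⊕ z)
      ⊕-comm : ∀ x y → x ⊕ y ≡ y ⊕ x
      ⊕-identityˡ : ∀ x → 0v ⊕ x ≡ x
      ·-distribˡ : ∀ a x y → a · (x ⊕ y) ≡ (a · x) ⊕ (a · y)
      ·-distribʳ : ∀ a b x → (a + b) · x ≡ (a · x) ⊕ (b · x)
      ·-assoc : ∀ a b x → a · (b · x) ≡ (a * b) · x
      ·-identity : ∀ x → 1# · x ≡ x
      ·-zero : ∀ x → 0# · x ≡ 0v

    infixl 6 _⊖_
    _⊖_ : V → V → V
    x ⊖ y = x ⊕ ((- 1#) · y)

    ⊕-identityʳ : ∀ x → x ⊕ 0v ≡ x
    ⊕-identityʳ x = trans (⊕-comm x 0v) (⊕-identityˡ x)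

    ⊖-self : ∀ x → x ⊖ x ≡ 0v
    ⊖-self x = begin
      x ⊕ ((- 1#) · x)          ≡⟨ cong (_⊕ ((- 1#) · x)) (sym (·-identity x)) ⟩
      (1# · x) ⊕ ((- 1#) · x)   ≡⟨ sym (·-distribʳ 1# (- 1#) x) ⟩
      (1# + (- 1#)) · x         ≡⟨ cong (_· x) (R.-‿inverseʳ 1#) ⟩
      0# · x                    ≡⟨ ·-zero x ⟩
      0v                        ∎
      where open ≡-Reasoning

    ⊖-⊕ : ∀ x y → (x ⊖ y) ⊕ y ≡ x
    ⊖-⊕ x y = trans (⊕-assoc x _ y) (trans (cong (x ⊕_) (trans (⊕-comm _ y) (⊖-self y))) (⊕-identityʳ x))

    ⊕-⊖ : ∀ x y → (x ⊕ y) ⊖ y ≡ x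
    ⊕-⊖ x y = trans (⊕-assoc x y _) (trans (cong (x ⊕_) (⊖-self y)) (⊕-identityʳ x))

    ⊖≡0⇒≡ : ∀ x y → x ⊖ y ≡ 0v → x ≡ y
    ⊖≡0⇒≡ x y e = trans (sym (⊖-⊕ x y)) (trans (cong (_⊕ y) e) (⊕-identityˡ y))

    ·-zeroʳ : ∀ a → a · 0v ≡ 0v
    ·-zeroʳ a = begin
      a · 0v          ≡⟨ cong (a ·_) (sym (·-zero 0v)) ⟩
      a · (0# · 0v)   ≡⟨ ·-assoc a 0# 0v ⟩
      (a * 0#) · 0v   ≡⟨ cong (_· 0v) (R.zeroʳ a) ⟩
      0# · 0v         ≡⟨ ·-zero 0v ⟩
      0v              ∎
      where open ≡-Reasoning

    ⊕-interchange : ∀ x y x′ y′ → (x ⊕ y) ⊕ (x′ ⊕ y′) ≡ (x ⊕ x′) ⊕ (y ⊕ y′)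
    ⊕-interchange x y x′ y′ = begin
      (x ⊕ y) ⊕ (x′ ⊕ y′)   ≡⟨ ⊕-assoc x y _ ⟩
      x ⊕ (y ⊕ (x′ ⊕ y′))   ≡⟨ cong (x ⊕_) (sym (⊕-assoc y x′ y′)) ⟩
      x ⊕ ((y ⊕ x′) ⊕ y′)   ≡⟨ cong (λ z → x ⊕ (z ⊕ y′)) (⊕-comm y x′) ⟩
      x ⊕ ((x′ ⊕ y) ⊕ y′)   ≡⟨ cong (x ⊕_) (⊕-assoc x′ y y′) ⟩
      x ⊕ (x′ ⊕ (y ⊕ y′))   ≡⟨ sym (⊕-assoc x x′ _) ⟩
      (x ⊕ x′) ⊕ (y ⊕ y′)   ∎
      where open ≡-Reasoning

  carrierLaws : VectorSpaceLaws 0# _+_ _*_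
  carrierLaws = record
    { ⊕-assoc = R.+-assoc ; ⊕-comm = R.+-comm ; ⊕-identityˡ = R.+-identityˡ
    ; ·-distribˡ = R.distribˡ ; ·-distribʳ = λ a b x → R.distribʳ x a b
    ; ·-assoc = λ a b x → sym (R.*-assoc a b x) ; ·-identity = R.*-identityˡ ; ·-zero = R.zeroˡ }

  vecLaws : {A : Set} {0a : A} {_⊕_ : A → A → A} {_·_ : Carrier → A → A} → VectorSpaceLaws 0a _⊕_ _·_ →
            (n : ℕ) → VectorSpaceLaws (Vec.replicate n 0a) (Vec.zipWith _⊕_) (λ a → Vec.map (a ·_))
  vecLaws {A} {0a} {_⊕_} {_·_} L n = record
    { ⊕-assoc = assoc ; ⊕-comm = comm ; ⊕-identityˡ = identityˡ ; ·-distribˡ = distribˡ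
    ; ·-distribʳ = distribʳ ; ·-assoc = ·assoc ; ·-identity = identity ; ·-zero = zero· }
    where
    module L = VectorSpaceLaws L
    assoc : ∀ {n} (x y z : Vec A n) → Vec.zipWith _⊕_ (Vec.zipWith _⊕_ x y) z ≡ Vec.zipWith _⊕_ x (Vec.zipWith _⊕_ y z)
    assoc Vec.[] Vec.[] Vec.[] = refl
    assoc (x Vec.∷ xs) (y Vec.∷ ys) (z Vec.∷ zs) = cong₂ Vec._∷_ (L.⊕-assoc x y z) (assoc xs ys zs)
    comm : ∀ {n} (x y : Vec A n) → Vec.zipWith _⊕_ x y ≡ Vec.zipWith _⊕_ y x
    comm Vec.[] Vec.[] = refl
    comm (x Vec.∷ xs) (y Vec.∷ ys) = cong₂ Vec._∷_ (L.⊕-comm x y) (comm xs ys)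
    identityˡ : ∀ {n} (x : Vec A n) → Vec.zipWith _⊕_ (Vec.replicate n 0a) x ≡ x
    identityˡ Vec.[] = refl
    identityˡ (x Vec.∷ xs) = cong₂ Vec._∷_ (L.⊕-identityˡ x) (identityˡ xs)
    distribˡ : ∀ {n} a (x y : Vec A n) →
               Vec.map (a ·_) (Vec.zipWith _⊕_ x y) ≡ Vec.zipWith _⊕_ (Vec.map (a ·_) x) (Vec.map (a ·_) y)
    distribˡ a Vec.[] Vec.[] = refl
    distribˡ a (x Vec.∷ xs) (y Vec.∷ ys) = cong₂ Vec._∷_ (L.·-distribˡ a x y) (distribˡ a xs ys)
    distribʳ : ∀ {n} a b (x : Vec A n) → Vec.map ((a + b) ·_) x ≡ Vec.zipWith _⊕_ (Vec.map (a ·_) x) (Vec.map (b ·_) x)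
    distribʳ a b Vec.[] = refl
    distribʳ a b (x Vec.∷ xs) = cong₂ Vec._∷_ (L.·-distribʳ a b x) (distribʳ a b xs)
    ·assoc : ∀ {n} a b (x : Vec A n) → Vec.map (a ·_) (Vec.map (b ·_) x) ≡ Vec.map ((a * b) ·_) x
    ·assoc a b Vec.[] = refl
    ·assoc a b (x Vec.∷ xs) = cong₂ Vec._∷_ (L.·-assoc a b x) (·assoc a b xs)
    identity : ∀ {n} (x : Vec A n) → Vec.map (1# ·_) x ≡ x
    identity Vec.[] = refl
    identity (x Vec.∷ xs) = cong₂ Vec._∷_ (L.·-identity x) (identity xs)
    zero· : ∀ {n} (x : Vec A n) → Vec.map (0# ·_) x ≡ Vec.replicate n 0a
    zero· Vec.[] = refl
    zero· (x Vec.∷ xs) = cong₂ Vec._∷_ (L.·-zero x) (zero· xs)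

  Fⁿ-laws : ∀ n → VectorSpaceLaws {Vec Carrier n} (vzero F) (vadd F) (vscale F)
  Fⁿ-laws n = vecLaws carrierLaws n

  Mat-laws : ∀ n m → VectorSpaceLaws {Mat F n m} (mzero F) (madd F) (mscale F)
  Mat-laws n m = vecLaws (Fⁿ-laws m) n

module Subspaces (F : FiniteField) {V : Set} (0v : V) (_⊕_ : V → V → V) (_·_ : FiniteField.Carrier F → V → V)
                 (laws : FieldFacts.VectorSpaceLaws F 0v _⊕_ _·_) (_≟V_ : DecidableEquality V)
                 {allV : List V} (enumeration : IsEnumeration allV) where
  open FieldFacts F
  open LinAlg F 0v _⊕_ _·_ (λ x y → ⌊ x ≟V y ⌋) allV public
  open VectorSpaceLaws laws

  allV-isEnumeration : IsEnumeration allV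
  allV-isEnumeration = enumeration

  ∈allV : ∀ v → v ∈ allV
  ∈allV = IsEnumeration.∈-complete allV-isEnumeration

  ∣_∣ : Sub → ℕ
  ∣ P ∣ = count P allV

  record IsSubspace (P : Sub) : Set where
    field
      0∈ : T (P 0v)
      ⊕∈ : ∀ x y → T (P x) → T (P y) → T (P (x ⊕ y))
      ·∈ : ∀ a x → T (P x) → T (P (a · x))

    ⊖∈ : ∀ x y → T (P x) → T (P y) → T (P (x ⊖ y))
    ⊖∈ x y px py = ⊕∈ x _ px (·∈ (- 1#) y py)

  isSubspace⁻ : ∀ P → T (isSubspace P) → IsSubspace P
  isSubspace⁻ P t = record { 0∈ = proj₁ (T-∧⁻ t) ; ⊕∈ = ⊕∈ ; ·∈ = ·∈ }
    where
    closed = proj₂ (T-∧⁻ {P 0v} t)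
    ⊕∈ : ∀ x y → T (P x) → T (P y) → T (P (x ⊕ y))
    ⊕∈ x y px py = T-not∨⁻ (allB⁻ _ (allB⁻ _ (proj₁ (T-∧⁻ closed)) (∈allV x)) (∈allV y)) (T-∧⁺ px py)
    ·∈ : ∀ a x → T (P x) → T (P (a · x))
    ·∈ a x px = T-not∨⁻ (allB⁻ _ (allB⁻ _ (proj₂ (T-∧⁻ {allB _ allV} closed)) (complete a)) (∈allV x)) px

  isSubspace⁺ : ∀ P → IsSubspace P → T (isSubspace P)
  isSubspace⁺ P s = T-∧⁺ 0∈ (T-∧⁺
    (allB⁺ _ allV (λ x → allB⁺ _ allV (λ y → T-not∨⁺ (λ pxy →
      ⊕∈ x y (proj₁ (T-∧⁻ pxy)) (proj₂ (T-∧⁻ {P x} pxy))))))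
    (allB⁺ _ elements (λ a → allB⁺ _ allV (λ x → T-not∨⁺ (·∈ a x)))))
    where open IsSubspace s

  ⊆ᵇ⁻ : ∀ P Q → T (P ⊆ᵇ Q) → ∀ v → T (P v) → T (Q v)
  ⊆ᵇ⁻ P Q t v = T-not∨⁻ (allB⁻ _ t (∈allV v))

  ⊆ᵇ⁺ : ∀ P Q → (∀ v → T (P v) → T (Q v)) → T (P ⊆ᵇ Q)
  ⊆ᵇ⁺ P Q h = allB⁺ _ allV (λ v → T-not∨⁺ (h v))

  ¬⊆ᵇ⁻ : ∀ P Q → ¬ T (P ⊆ᵇ Q) → Σ V (λ v → T (P v) × ¬ T (Q v))
  ¬⊆ᵇ⁻ P Q n = let (v , nv) = ¬allB⁻ _ allV n in v , ¬T-not∨⁻ nv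

  ⊆ᵇ-trans : ∀ P Q W → T (P ⊆ᵇ Q) → T (Q ⊆ᵇ W) → T (P ⊆ᵇ W)
  ⊆ᵇ-trans P Q W t₁ t₂ = ⊆ᵇ⁺ P W (λ v pv → ⊆ᵇ⁻ Q W t₂ v (⊆ᵇ⁻ P Q t₁ v pv))

  ≗ᵇ⁻ : ∀ P Q → T (P ≗ᵇ Q) → ∀ v → P v ≡ Q v
  ≗ᵇ⁻ P Q t v = T-ext (⊆ᵇ⁻ P Q (proj₁ (T-∧⁻ t)) v) (⊆ᵇ⁻ Q P (proj₂ (T-∧⁻ {P ⊆ᵇ Q} t)) v)

  ≗ᵇ⁺ : ∀ P Q → (∀ v → P v ≡ Q v) → T (P ≗ᵇ Q)
  ≗ᵇ⁺ P Q h = T-∧⁺ (⊆ᵇ⁺ P Q (λ v → subst T (h v))) (⊆ᵇ⁺ Q P (λ v → subst T (sym (h v))))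

  IsSubspace-resp : ∀ {P Q} → (∀ v → P v ≡ Q v) → IsSubspace Q → IsSubspace P
  IsSubspace-resp {P} {Q} e s = record
    { 0∈ = to (0∈ s)
    ; ⊕∈ = λ x y px py → to (⊕∈ s x y (from px) (from py))
    ; ·∈ = λ a x px → to (·∈ s a x (from px)) }
    where
    open IsSubspace
    to : ∀ {v} → T (Q v) → T (P v)
    to {v} = subst T (sym (e v))
    from : ∀ {v} → T (P v) → T (Q v)
    from {v} = subst T (e v)

  isSubspace-resp : ∀ {P Q} → (∀ v → P v ≡ Q v) → isSubspace P ≡ isSubspace Q
  isSubspace-resp {P} {Q} e =
    T-ext (λ t → isSubspace⁺ Q (IsSubspace-resp (λ v → sym (e v)) (isSubspace⁻ P t)))
          (λ t → isSubspace⁺ P (IsSubspace-resp e (isSubspace⁻ Q t)))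

  ⊆ᵇ-respˡ : ∀ P P′ Q → (∀ v → P v ≡ P′ v) → (P ⊆ᵇ Q) ≡ (P′ ⊆ᵇ Q)
  ⊆ᵇ-respˡ P P′ Q e = T-ext (λ t → ⊆ᵇ⁺ P′ Q (λ v p′v → ⊆ᵇ⁻ P Q t v (subst T (sym (e v)) p′v)))
                            (λ t → ⊆ᵇ⁺ P Q (λ v pv → ⊆ᵇ⁻ P′ Q t v (subst T (e v) pv)))

  ⊆ᵇ-respʳ : ∀ P Q Q′ → (∀ v → Q v ≡ Q′ v) → (P ⊆ᵇ Q) ≡ (P ⊆ᵇ Q′)
  ⊆ᵇ-respʳ P Q Q′ e = T-ext (λ t → ⊆ᵇ⁺ P Q′ (λ v pv → subst T (e v) (⊆ᵇ⁻ P Q t v pv)))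
                            (λ t → ⊆ᵇ⁺ P Q (λ v pv → subst T (sym (e v)) (⊆ᵇ⁻ P Q′ t v pv)))

  infixr 30 _∩_
  _∩_ : Sub → Sub → Sub
  (P ∩ Q) v = P v ∧ Q v

  ∩-IsSubspace : ∀ {P Q} → IsSubspace P → IsSubspace Q → IsSubspace (P ∩ Q)
  ∩-IsSubspace {P} s t = record
    { 0∈ = T-∧⁺ (0∈ s) (0∈ t)
    ; ⊕∈ = λ x y px py → T-∧⁺ (⊕∈ s x y (proj₁ (T-∧⁻ px)) (proj₁ (T-∧⁻ py)))
                              (⊕∈ t x y (proj₂ (T-∧⁻ {P x} px)) (proj₂ (T-∧⁻ {P y} py)))
    ; ·∈ = λ a x px → T-∧⁺ (·∈ s a x (proj₁ (T-∧⁻ px))) (·∈ t a x (proj₂ (T-∧⁻ {P x} px))) }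
    where open IsSubspace

  ⊆ᵇ-∩ : ∀ P Q W → (P ⊆ᵇ (Q ∩ W)) ≡ (P ⊆ᵇ Q ∧ P ⊆ᵇ W)
  ⊆ᵇ-∩ P Q W = T-ext
    (λ t → T-∧⁺ (⊆ᵇ⁺ P Q (λ v Pv → proj₁ (T-∧⁻ (⊆ᵇ⁻ P (Q ∩ W) t v Pv))))
                (⊆ᵇ⁺ P W (λ v Pv → proj₂ (T-∧⁻ {Q v} (⊆ᵇ⁻ P (Q ∩ W) t v Pv)))))
    (λ t → ⊆ᵇ⁺ P (Q ∩ W) (λ v Pv →
      T-∧⁺ (⊆ᵇ⁻ P Q (proj₁ (T-∧⁻ t)) v Pv) (⊆ᵇ⁻ P W (proj₂ (T-∧⁻ {P ⊆ᵇ Q} t)) v Pv)))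

  ∣∣-cong : ∀ {P Q} → (∀ v → P v ≡ Q v) → ∣ P ∣ ≡ ∣ Q ∣
  ∣∣-cong e = ℕ∑.∑-cong allV (λ v → cong ℕ∑.[_] (e v))

  ∣∣-mono : ∀ {P Q} → (∀ v → T (P v) → T (Q v)) → ∣ P ∣ ≤ ∣ Q ∣
  ∣∣-mono h = count-mono _ _ allV h

  lincomb-+ : ∀ {d} (c c′ : Vec Carrier d) (b : Vec V d) → lincomb (vadd F c c′) b ≡ lincomb c b ⊕ lincomb c′ b
  lincomb-+ Vec.[] Vec.[] Vec.[] = sym (⊕-identityˡ 0v)
  lincomb-+ (c Vec.∷ cs) (c′ Vec.∷ cs′) (b Vec.∷ bs) =
    trans (cong₂ _⊕_ (·-distribʳ c c′ b) (lincomb-+ cs cs′ bs)) (⊕-interchange (c · b) (c′ · b) _ _)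

  lincomb-* : ∀ {d} a (c : Vec Carrier d) (b : Vec V d) → lincomb (vscale F a c) b ≡ a · lincomb c b
  lincomb-* a Vec.[] Vec.[] = sym (·-zeroʳ a)
  lincomb-* a (c Vec.∷ cs) (b Vec.∷ bs) =
    trans (cong₂ _⊕_ (sym (·-assoc a c b)) (lincomb-* a cs bs)) (sym (·-distribˡ a (c · b) _))

  lincomb-injective : ∀ {d} (b : Vec V d) → LinIndep b → ∀ c c′ → lincomb c b ≡ lincomb c′ b → c ≡ c′
  lincomb-injective {d} b independent c c′ e =
    VectorSpaceLaws.⊖≡0⇒≡ (Fⁿ-laws d) c c′ (independent _ (begin
      lincomb (vadd F c (vscale F (- 1#) c′)) b
        ≡⟨ lincomb-+ c _ b ⟩
      lincomb c b ⊕ lincomb (vscale F (- 1#) c′) b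
        ≡⟨ cong (lincomb c b ⊕_) (lincomb-* (- 1#) c′ b) ⟩
      lincomb c b ⊖ lincomb c′ b
        ≡⟨ cong (_⊖ lincomb c′ b) e ⟩
      lincomb c′ b ⊖ lincomb c′ b
        ≡⟨ ⊖-self _ ⟩
      0v ∎))
    where open ≡-Reasoning

  lincomb-∈ : ∀ {P} → IsSubspace P → ∀ {d} (b : Vec V d) → (∀ i → T (P (Vec.lookup b i))) →
              ∀ c → T (P (lincomb c b))
  lincomb-∈ s Vec.[] _ Vec.[] = IsSubspace.0∈ s
  lincomb-∈ s (b Vec.∷ bs) b∈P (c Vec.∷ cs) =
    IsSubspace.⊕∈ s _ _ (IsSubspace.·∈ s c b (b∈P Fin.zero)) (lincomb-∈ s bs (λ i → b∈P (Fin.suc i)) cs)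

  -- Every vector of P has exactly one coordinate vector, so |P| = |F^d|.
  HasDim⇒∣∣≡q^ : ∀ {P} → IsSubspace P → ∀ d → HasDim P d → ∣ P ∣ ≡ q ℕ.^ d
  HasDim⇒∣∣≡q^ {P} s d (b , b∈P , independent , spanning) = begin
    ∣ P ∣
      ≡⟨ ℕ∑.∑-cong allV coordinates ⟩
    ℕ∑.∑ (λ v → count (λ c → ⌊ v ≟V lincomb c b ⌋) Fᵈ) allV
      ≡⟨ ℕ∑.∑-swap _ allV Fᵈ ⟩
    ℕ∑.∑ (λ c → count (λ v → ⌊ v ≟V lincomb c b ⌋) allV) Fᵈ
      ≡⟨ ℕ∑.∑-cong Fᵈ (λ c → count-≟ _≟V_ allV-isEnumeration (lincomb c b)) ⟩
    ℕ∑.∑ (λ _ → 1) Fᵈ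
      ≡⟨ ∑-allVecsOf-1 elements d ⟩
    q ℕ.^ d ∎
    where
    open ≡-Reasoning
    Fᵈ = allVecs F d
    Fᵈ-isEnumeration = allVecsOf-isEnumeration elements-isEnumeration d
    coordinates : ∀ v → ℕ∑.[ P v ] ≡ count (λ c → ⌊ v ≟V lincomb c b ⌋) Fᵈ
    coordinates v with P v in eq
    ... | true = let (c₀ , c₀-coords) = spanning v (≡true⇒T eq) in sym (begin
      count (λ c → ⌊ v ≟V lincomb c b ⌋) Fᵈ
        ≡⟨ ℕ∑.∑-cong Fᵈ (λ c → cong ℕ∑.[_] (⌊⌋-cong (v ≟V lincomb c b) (VecP.≡-dec _≟_ c c₀)
             (λ e → lincomb-injective b independent c c₀ (trans (sym e) (sym c₀-coords)))
             (λ e → trans (sym c₀-coords) (cong (λ z → lincomb z b) (sym e))))) ⟩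
      count (λ c → ⌊ VecP.≡-dec _≟_ c c₀ ⌋) Fᵈ
        ≡⟨ count-≟ (VecP.≡-dec _≟_) Fᵈ-isEnumeration c₀ ⟩
      1 ∎)
    ... | false = sym (ℕ∑.∑-zero Fᵈ no-coordinates)
      where
      no-coordinates : ∀ c → ℕ∑.[ ⌊ v ≟V lincomb c b ⌋ ] ≡ 0
      no-coordinates c with v ≟V lincomb c b
      ... | yes refl = ⊥-elim (≡false⇒¬T eq (lincomb-∈ s b b∈P c))
      ... | no _ = refl

  allV-unique : Unique allV
  allV-unique = IsEnumeration.unique allV-isEnumeration

  module _ {A : Set} {_+_ _*_ : Op₂ A} {0# 1# : A} (isS : IsSemiring _≡_ _+_ _*_ 0# 1#) where
    open ListSum isS

    -- allSubsets is built from the list of all truth tables on allV, in which each table occurs once.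
    ∑-allSubsets-δ : ∀ P (g : Sub → A) → (∀ Q → T (Q ≗ᵇ P) → g Q ≡ g P) →
                     ∑ (λ Q → if Q ≗ᵇ P then g Q else 0#) allSubsets ≡ g P
    ∑-allSubsets-δ P g g-resp = begin
      ∑ (λ Q → if Q ≗ᵇ P then g Q else 0#) allSubsets
        ≡⟨ ∑-map _ subsetOf (allTables N) ⟩
      ∑ (λ t → if subsetOf t ≗ᵇ P then g (subsetOf t) else 0#) (allTables N)
        ≡⟨ ∑-cong-∈ (allTables N) (λ {t} t∈ → cong (λ b → if b then g (subsetOf t) else 0#)
                                                   (≗ᵇ⇔table t (allTables-length N t∈))) ⟩
      ∑ (λ t → if ⌊ ListP.≡-dec BoolP._≟_ t tableP ⌋ then g (subsetOf t) else 0#) (allTables N)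
        ≡⟨ ∑-δ (ListP.≡-dec BoolP._≟_) (λ t → g (subsetOf t)) (allTables-unique N)
               (subst (λ k → tableP ∈ allTables k) (ListP.length-map P allV) (∈-allTables tableP)) ⟩
      g (subsetOf tableP)
        ≡⟨ g-resp _ (≗ᵇ⁺ _ P (λ v → memberOf-map _≟V_ P allV (∈allV v))) ⟩
      g P ∎
      where
      open ≡-Reasoning
      N = length allV
      subsetOf : List Bool → Sub
      subsetOf t = memberOf (λ x y → ⌊ x ≟V y ⌋) t allV
      tableP = map P allV
      ≗ᵇ⇔table : ∀ t → length t ≡ N → (subsetOf t ≗ᵇ P) ≡ ⌊ ListP.≡-dec BoolP._≟_ t tableP ⌋
      ≗ᵇ⇔table t len = T-ext
        (λ t≗P → fromWitness (memberOf⇒≡map _≟V_ P allV-unique t len (λ {v} _ → ≗ᵇ⁻ _ P t≗P v)))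
        (λ t≡ → ≗ᵇ⁺ _ P (λ v → trans (cong (λ s → memberOf _ s allV v) (toWitness t≡))
                                      (memberOf-map _≟V_ P allV (∈allV v))))

module _ {q : ℕ} (1<q : 1 ℕ.< q) where

  ^-cancelʳ-≤ : ∀ a b → q ℕ.^ a ≤ q ℕ.^ b → a ≤ b
  ^-cancelʳ-≤ a b qᵃ≤qᵇ with a ℕ.≤? b
  ... | yes a≤b = a≤b
  ... | no a≰b = ⊥-elim (ℕP.<⇒≱ (ℕP.^-monoʳ-< q 1<q (ℕP.≰⇒> a≰b)) qᵃ≤qᵇ)

  ^-injectiveʳ : ∀ a b → q ℕ.^ a ≡ q ℕ.^ b → a ≡ b
  ^-injectiveʳ a b e = ℕP.≤-antisym (^-cancelʳ-≤ a b (ℕP.≤-reflexive e)) (^-cancelʳ-≤ b a (ℕP.≤-reflexive (sym e)))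

  *-^-cancelʳ : ∀ x b c → b ≤ c → x ℕ.* q ℕ.^ b ≡ q ℕ.^ c → x ≡ q ℕ.^ (c ∸ b)
  *-^-cancelʳ x b c b≤c e = ℕP.*-cancelʳ-≡ x (q ℕ.^ (c ∸ b)) (q ℕ.^ b) {{ℕP.m^n≢0 q b {{q≢0}}}}
    (trans e (trans (cong (q ℕ.^_) (sym (ℕP.m∸n+n≡m b≤c))) (ℕP.^-distribˡ-+-* q (c ∸ b) b)))
    where
    q≢0 : ℕ.NonZero q
    q≢0 = ℕ.>-nonZero (ℕP.<-trans (s≤s z≤n) 1<q)

∸-+-∸ : ∀ {a b c} → a ≤ b → b ≤ c → (b ∸ a) ℕ.+ (c ∸ b) ≡ c ∸ a
∸-+-∸ {a} {b} {c} a≤b b≤c = sym (begin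
  c ∸ a                    ≡⟨ cong (_∸ a) (sym (ℕP.m∸n+n≡m b≤c)) ⟩
  (c ∸ b) ℕ.+ b ∸ a        ≡⟨ ℕP.+-∸-assoc (c ∸ b) a≤b ⟩
  (c ∸ b) ℕ.+ (b ∸ a)      ≡⟨ ℕP.+-comm (c ∸ b) (b ∸ a) ⟩
  (b ∸ a) ℕ.+ (c ∸ b)      ∎)
  where open ≡-Reasoning

möbiusCoeff : ℕ → ℕ → ℤ
möbiusCoeff q j = (ℤ.- (+ 1)) ℤ.^ j ℤ.* (+ (q ℕ.^ (j choose 2)))

möbiusCoeff-suc : ∀ q j → möbiusCoeff q (suc j) ≡ (ℤ.- (+ (q ℕ.^ j))) ℤ.* möbiusCoeff q j
möbiusCoeff-suc q j = begin
  ((ℤ.- (+ 1)) ℤ.* s) ℤ.* (+ (q ℕ.^ (suc j choose 2)))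
    ≡⟨ cong (λ k → ((ℤ.- (+ 1)) ℤ.* s) ℤ.* (+ (q ℕ.^ k))) [1+j]C2≡j+jC2 ⟩
  ((ℤ.- (+ 1)) ℤ.* s) ℤ.* (+ (q ℕ.^ (j ℕ.+ j choose 2)))
    ≡⟨ cong (λ k → ((ℤ.- (+ 1)) ℤ.* s) ℤ.* (+ k)) (ℕP.^-distribˡ-+-* q j (j choose 2)) ⟩
  ((ℤ.- (+ 1)) ℤ.* s) ℤ.* (+ (q ℕ.^ j ℕ.* q ℕ.^ (j choose 2)))
    ≡⟨ cong (((ℤ.- (+ 1)) ℤ.* s) ℤ.*_) (ℤP.pos-* (q ℕ.^ j) (q ℕ.^ (j choose 2))) ⟩
  ((ℤ.- (+ 1)) ℤ.* s) ℤ.* ((+ (q ℕ.^ j)) ℤ.* (+ (q ℕ.^ (j choose 2))))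
    ≡⟨ solve 3 (λ s a b → ((:- con (+ 1)) :* s) :* (a :* b) := (:- a) :* (s :* b)) refl
             s (+ (q ℕ.^ j)) (+ (q ℕ.^ (j choose 2))) ⟩
  (ℤ.- (+ (q ℕ.^ j))) ℤ.* möbiusCoeff q j ∎
  where
  open ≡-Reasoning
  open +-*-Solver
  s = (ℤ.- (+ 1)) ℤ.^ j
  [1+j]C2≡j+jC2 : suc j choose 2 ≡ j ℕ.+ j choose 2
  [1+j]C2≡j+jC2 = sym (trans (cong (ℕ._+ (j choose 2)) (sym (nC1≡n j))) (nCk+nC[k+1]≡[n+1]C[k+1] j 1))

-- Orthogonal complements in Fⁿ

module Fⁿ (F : FiniteField) where
  open FieldFacts F public

  module SubFⁿ (n : ℕ) = Subspaces F (vzero F) (vadd F) (vscale F) (Fⁿ-laws n) (VecP.≡-dec _≟_)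
                                     (allVecsOf-isEnumeration elements-isEnumeration n)

  module VL {n : ℕ} = VectorSpaceLaws (Fⁿ-laws n)
  module CL = VectorSpaceLaws carrierLaws

  infixl 6 _⊕_ _⊖_
  infixr 7 _·_
  infix 25 _∙_

  _⊕_ : ∀ {n} → Vec Carrier n → Vec Carrier n → Vec Carrier n
  _⊕_ = vadd F

  _·_ : ∀ {n} → Carrier → Vec Carrier n → Vec Carrier n
  _·_ = vscale F

  _⊖_ : ∀ {n} → Vec Carrier n → Vec Carrier n → Vec Carrier n
  _⊖_ = VL._⊖_

  0v : ∀ {n} → Vec Carrier n
  0v = vzero F

  _∙_ : ∀ {n} → Vec Carrier n → Vec Carrier n → Carrier
  _∙_ = dot F

  infix 35 _^⊥
  _^⊥ : ∀ {n} → E.Sub F n → E.Sub F n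
  _^⊥ = _⊥ F

  vneg≡-1· : ∀ {n} (u : Vec Carrier n) → vneg F u ≡ (- 1#) · u
  vneg≡-1· Vec.[] = refl
  vneg≡-1· (a Vec.∷ u) = cong₂ Vec._∷_ (sym (-1*≡- a)) (vneg≡-1· u)

  ∙-comm : ∀ {n} (u v : Vec Carrier n) → u ∙ v ≡ v ∙ u
  ∙-comm Vec.[] Vec.[] = refl
  ∙-comm (a Vec.∷ u) (b Vec.∷ v) = cong₂ _+_ (R.*-comm a b) (∙-comm u v)

  ∙-⊕ˡ : ∀ {n} (u u′ v : Vec Carrier n) → (u ⊕ u′) ∙ v ≡ u ∙ v + u′ ∙ v
  ∙-⊕ˡ Vec.[] Vec.[] Vec.[] = sym (R.+-identityˡ 0#)
  ∙-⊕ˡ (a Vec.∷ u) (a′ Vec.∷ u′) (b Vec.∷ v) =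
    trans (cong₂ _+_ (R.distribʳ b a a′) (∙-⊕ˡ u u′ v)) (CL.⊕-interchange (a * b) (a′ * b) _ _)

  ∙-·ˡ : ∀ {n} c (u v : Vec Carrier n) → (c · u) ∙ v ≡ c * (u ∙ v)
  ∙-·ˡ c Vec.[] Vec.[] = sym (R.zeroʳ c)
  ∙-·ˡ c (a Vec.∷ u) (b Vec.∷ v) =
    trans (cong₂ _+_ (R.*-assoc c a b) (∙-·ˡ c u v)) (sym (R.distribˡ c (a * b) _))

  ∙-0ˡ : ∀ {n} (v : Vec Carrier n) → 0v ∙ v ≡ 0#
  ∙-0ˡ Vec.[] = refl
  ∙-0ˡ (b Vec.∷ v) = trans (cong₂ _+_ (R.zeroˡ b) (∙-0ˡ v)) (R.+-identityˡ 0#)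

  ∙-⊕ʳ : ∀ {n} (u v v′ : Vec Carrier n) → u ∙ (v ⊕ v′) ≡ u ∙ v + u ∙ v′
  ∙-⊕ʳ u v v′ = trans (∙-comm u _) (trans (∙-⊕ˡ v v′ u) (cong₂ _+_ (∙-comm v u) (∙-comm v′ u)))

  ∙-·ʳ : ∀ {n} c (u v : Vec Carrier n) → u ∙ (c · v) ≡ c * (u ∙ v)
  ∙-·ʳ c u v = trans (∙-comm u _) (trans (∙-·ˡ c v u) (cong (c *_) (∙-comm v u)))

  ∙-0ʳ : ∀ {n} (v : Vec Carrier n) → v ∙ 0v ≡ 0#
  ∙-0ʳ v = trans (∙-comm v 0v) (∙-0ˡ v)

  ∙-⊖ˡ : ∀ {n} (u v w : Vec Carrier n) → (v ⊖ w) ∙ u ≡ v ∙ u + ((- 1#) * (w ∙ u))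
  ∙-⊖ˡ u v w = trans (∙-⊕ˡ v _ u) (cong (_+_ (v ∙ u)) (∙-·ˡ (- 1#) w u))

  ∙-⊖ʳ : ∀ {n} (u v w : Vec Carrier n) → u ∙ (v ⊖ w) ≡ u ∙ v + ((- 1#) * (u ∙ w))
  ∙-⊖ʳ u v w = trans (∙-⊕ʳ u v _) (cong (_+_ (u ∙ v)) (∙-·ʳ (- 1#) u w))

  ^⊥⁻ : ∀ {n} (U : E.Sub F n) {v} → T ((U ^⊥) v) → ∀ u → T (U u) → u ∙ v ≡ 0#
  ^⊥⁻ {n} U t u Uu = toWitness (T-not∨⁻ (allB⁻ _ t (SubFⁿ.∈allV n u)) Uu)

  ^⊥⁺ : ∀ {n} (U : E.Sub F n) v → (∀ u → T (U u) → u ∙ v ≡ 0#) → T ((U ^⊥) v)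
  ^⊥⁺ {n} U v h = allB⁺ _ (allVecs F n) (λ u → T-not∨⁺ (λ Uu → fromWitness (h u Uu)))

  ^⊥-IsSubspace : ∀ {n} (U : E.Sub F n) → SubFⁿ.IsSubspace n (U ^⊥)
  ^⊥-IsSubspace U = record
    { 0∈ = ^⊥⁺ U _ (λ u _ → ∙-0ʳ u)
    ; ⊕∈ = λ x y x⊥ y⊥ → ^⊥⁺ U _ (λ u Uu →
        trans (∙-⊕ʳ u x y) (trans (cong₂ _+_ (^⊥⁻ U x⊥ u Uu) (^⊥⁻ U y⊥ u Uu)) (R.+-identityˡ 0#)))
    ; ·∈ = λ a x x⊥ → ^⊥⁺ U _ (λ u Uu → trans (∙-·ʳ a u x) (trans (cong (a *_) (^⊥⁻ U x⊥ u Uu)) (R.zeroʳ a))) }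

  ^⊥-galois : ∀ {n} (P Q : E.Sub F n) → T (E._⊆ᵇ_ F n P (Q ^⊥)) → T (E._⊆ᵇ_ F n Q (P ^⊥))
  ^⊥-galois {n} P Q t = SubFⁿ.⊆ᵇ⁺ n Q (P ^⊥) (λ u Qu → ^⊥⁺ P u (λ v Pv →
    trans (∙-comm v u) (^⊥⁻ Q (SubFⁿ.⊆ᵇ⁻ n P (Q ^⊥) t v Pv) u Qu)))

  ^⊥-antitone : ∀ {n} (P Q : E.Sub F n) → (∀ v → T (P v) → T (Q v)) → ∀ v → T ((Q ^⊥) v) → T ((P ^⊥) v)
  ^⊥-antitone P Q P⊆Q v t = ^⊥⁺ P v (λ u Pu → ^⊥⁻ Q t u (P⊆Q u Pu))

  ⊆^⊥^⊥ : ∀ {n} (U : E.Sub F n) v → T (U v) → T ((U ^⊥ ^⊥) v)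
  ⊆^⊥^⊥ U v Uv = ^⊥⁺ (U ^⊥) v (λ u u⊥ → trans (∙-comm u v) (^⊥⁻ U u⊥ v Uv))

  Separator : ∀ {n} → E.Sub F n → Vec Carrier n → Set
  Separator {n} W v = Σ (Vec Carrier n) (λ u → T ((W ^⊥) u) × u ∙ v ≢ 0#)

  slice₀ : ∀ {n} → E.Sub F (suc n) → E.Sub F n
  slice₀ W w = W (0# Vec.∷ w)

  slice₀-IsSubspace : ∀ {n} (W : E.Sub F (suc n)) → SubFⁿ.IsSubspace (suc n) W → SubFⁿ.IsSubspace n (slice₀ W)
  slice₀-IsSubspace {n} W s = record
    { 0∈ = 0∈
    ; ⊕∈ = λ x y px py → subst (λ c → T (W (c Vec.∷ (x ⊕ y)))) (R.+-identityˡ 0#) (⊕∈ _ _ px py)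
    ; ·∈ = λ a x px → subst (λ c → T (W (c Vec.∷ (a · x)))) (R.zeroʳ a) (·∈ a _ px) }
    where open SubFⁿ.IsSubspace (suc n) s

  module _ {n : ℕ} (W : E.Sub F (suc n)) (sW : SubFⁿ.IsSubspace (suc n) W)
           (separate-slice : ∀ v′ → ¬ T (slice₀ W v′) → Separator (slice₀ W) v′) where
    open SubFⁿ.IsSubspace (suc n) sW

    -- Subtracting multiples of the pivot (1 ∷ z) reduces W to its slice, where the induction applies.
    separator-with-pivot : ∀ z → T (W (1# Vec.∷ z)) → ∀ a v′ → ¬ T (W (a Vec.∷ v′)) → Separator W (a Vec.∷ v′)
    separator-with-pivot z pivot a v′ v∉W = u , ^⊥⁺ W u u⊥W , u∙v≢0
      where
      reduce : ∀ c x → T (W (c Vec.∷ x)) → T (slice₀ W (x ⊖ c · z))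
      reduce c x cx∈W = subst (λ d → T (W (d Vec.∷ (x ⊖ c · z))))
        (trans (cong (λ t → c + ((- 1#) * t)) (R.*-identityʳ c)) (x+-1*x≡0 c))
        (⊖∈ _ _ cx∈W (·∈ c _ pivot))
      reduced-v∉ : ¬ T (slice₀ W (v′ ⊖ a · z))
      reduced-v∉ t = v∉W (subst (λ y → T (W y))
        (cong₂ Vec._∷_ (trans (R.+-identityˡ _) (R.*-identityʳ a)) (VL.⊖-⊕ v′ (a · z)))
        (⊕∈ _ _ t (·∈ a _ pivot)))
      separator = separate-slice (v′ ⊖ a · z) reduced-v∉
      u′ = proj₁ separator
      u = (- (z ∙ u′)) Vec.∷ u′
      u⊥W : ∀ w → T (W w) → w ∙ u ≡ 0#
      u⊥W (c Vec.∷ w′) w∈W = begin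
        (c * (- (z ∙ u′))) + w′ ∙ u′
          ≡⟨ x*-y+z≡z+-1*[x*y] c (z ∙ u′) (w′ ∙ u′) ⟩
        w′ ∙ u′ + ((- 1#) * (c * (z ∙ u′)))
          ≡⟨ cong (λ t → w′ ∙ u′ + ((- 1#) * t)) (sym (∙-·ˡ c z u′)) ⟩
        w′ ∙ u′ + ((- 1#) * ((c · z) ∙ u′))
          ≡⟨ sym (∙-⊖ˡ u′ w′ (c · z)) ⟩
        (w′ ⊖ c · z) ∙ u′
          ≡⟨ ^⊥⁻ (slice₀ W) (proj₁ (proj₂ separator)) _ (reduce c w′ w∈W) ⟩
        0# ∎
        where open ≡-Reasoning
      u∙v≢0 : u ∙ (a Vec.∷ v′) ≢ 0#
      u∙v≢0 e = proj₂ (proj₂ separator) (trans (sym (begin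
        ((- (z ∙ u′)) * a) + u′ ∙ v′
          ≡⟨ cong (_+ u′ ∙ v′) (R.*-comm _ a) ⟩
        (a * (- (z ∙ u′))) + u′ ∙ v′
          ≡⟨ x*-y+z≡z+-1*[x*y] a (z ∙ u′) (u′ ∙ v′) ⟩
        u′ ∙ v′ + ((- 1#) * (a * (z ∙ u′)))
          ≡⟨ cong (λ t → u′ ∙ v′ + ((- 1#) * (a * t))) (∙-comm z u′) ⟩
        u′ ∙ v′ + ((- 1#) * (a * (u′ ∙ z)))
          ≡⟨ cong (λ t → u′ ∙ v′ + ((- 1#) * t)) (sym (∙-·ʳ a u′ z)) ⟩
        u′ ∙ v′ + ((- 1#) * (u′ ∙ (a · z)))
          ≡⟨ sym (∙-⊖ʳ u′ v′ (a · z)) ⟩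
        u′ ∙ (v′ ⊖ a · z) ∎)) e)
        where open ≡-Reasoning

    separator-without-pivot : (∀ w → T (W w) → Vec.head w ≡ 0#) →
                              ∀ a v′ → ¬ T (W (a Vec.∷ v′)) → Separator W (a Vec.∷ v′)
    separator-without-pivot heads≡0 a v′ v∉W with a ≟ 0#
    ... | no a≢0 = (1# Vec.∷ 0v) , ^⊥⁺ W _ first⊥W , first∙v≢0
      where
      first⊥W : ∀ w → T (W w) → w ∙ (1# Vec.∷ 0v) ≡ 0#
      first⊥W (c Vec.∷ w′) w∈W =
        trans (cong₂ _+_ (trans (cong (_* 1#) (heads≡0 _ w∈W)) (R.zeroˡ 1#)) (∙-0ʳ w′)) (R.+-identityˡ 0#)
      first∙v≢0 : (1# Vec.∷ 0v) ∙ (a Vec.∷ v′) ≢ 0#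
      first∙v≢0 e = a≢0 (trans (sym (trans (cong₂ _+_ (R.*-identityˡ a) (∙-0ˡ v′)) (R.+-identityʳ a))) e)
    ... | yes refl = (0# Vec.∷ u′) , ^⊥⁺ W _ u⊥W , u∙v≢0
      where
      separator = separate-slice v′ v∉W
      u′ = proj₁ separator
      u⊥W : ∀ w → T (W w) → w ∙ (0# Vec.∷ u′) ≡ 0#
      u⊥W (c Vec.∷ w′) w∈W = trans (cong₂ _+_ (R.zeroʳ c)
        (^⊥⁻ (slice₀ W) (proj₁ (proj₂ separator)) w′ (subst (λ d → T (W (d Vec.∷ w′))) (heads≡0 _ w∈W) w∈W)))
        (R.+-identityˡ 0#)
      u∙v≢0 : (0# Vec.∷ u′) ∙ (0# Vec.∷ v′) ≢ 0#
      u∙v≢0 e = proj₂ (proj₂ separator) (trans (sym (trans (cong (_+ u′ ∙ v′) (R.zeroˡ 0#)) (R.+-identityˡ _))) e)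

  separating-vector : ∀ n (W : E.Sub F n) → SubFⁿ.IsSubspace n W → ∀ v → ¬ T (W v) → Separator W v
  separating-vector zero W sW Vec.[] v∉W = ⊥-elim (v∉W (SubFⁿ.IsSubspace.0∈ sW))
  separating-vector (suc n) W sW (a Vec.∷ v′) v∉W
    with anyB (λ w → W w ∧ not ⌊ Vec.head w ≟ 0# ⌋) (allVecs F (suc n)) in pivots
  ... | true = normalise-pivot (anyB⁻ _ (allVecs F (suc n)) (≡true⇒T pivots))
    where
    IH = separating-vector n (slice₀ W) (slice₀-IsSubspace W sW)
    normalise-pivot : Σ (Vec Carrier (suc n)) (λ w → T (W w ∧ not ⌊ Vec.head w ≟ 0# ⌋)) → Separator W (a Vec.∷ v′)
    normalise-pivot ((b Vec.∷ z) , t) = separator-with-pivot W sW IH (b⁻¹ · z) pivot a v′ v∉W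
      where
      bz∈W = proj₁ (T-∧⁻ t)
      b≢0 : b ≢ 0#
      b≢0 b≡0 = T-not⁻ (proj₂ (T-∧⁻ {W (b Vec.∷ z)} t)) (fromWitness b≡0)
      b⁻¹ = proj₁ (inverse b b≢0)
      pivot : T (W (1# Vec.∷ (b⁻¹ · z)))
      pivot = subst (λ c → T (W (c Vec.∷ (b⁻¹ · z)))) (trans (R.*-comm b⁻¹ b) (proj₂ (inverse b b≢0)))
                    (SubFⁿ.IsSubspace.·∈ sW b⁻¹ _ bz∈W)
  ... | false = separator-without-pivot W sW IH heads≡0 a v′ v∉W
    where
    IH = separating-vector n (slice₀ W) (slice₀-IsSubspace W sW)
    heads≡0 : ∀ w → T (W w) → Vec.head w ≡ 0#
    heads≡0 w w∈W with Vec.head w ≟ 0#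
    ... | yes e = e
    ... | no h≢0 = ⊥-elim (≡false⇒¬T pivots
      (anyB⁺ _ (SubFⁿ.∈allV (suc n) w) (T-∧⁺ w∈W (T-not⁺ (λ t → h≢0 (toWitness t))))))

  ^⊥^⊥⊆ : ∀ {n} (W : E.Sub F n) → SubFⁿ.IsSubspace n W → ∀ v → T ((W ^⊥ ^⊥) v) → T (W v)
  ^⊥^⊥⊆ {n} W sW v v⊥⊥ with W v in eq
  ... | true = tt
  ... | false = let (u , u⊥W , u∙v≢0) = separating-vector n W sW v (≡false⇒¬T eq) in
    ⊥-elim (u∙v≢0 (^⊥⁻ (W ^⊥) v⊥⊥ u u⊥W))

  ^⊥-⊆ᵇ-^⊥ : ∀ {n} (S W : E.Sub F n) → SubFⁿ.IsSubspace n W → E._⊆ᵇ_ F n (W ^⊥) (S ^⊥) ≡ E._⊆ᵇ_ F n S W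
  ^⊥-⊆ᵇ-^⊥ {n} S W sW = T-ext
    (λ t → SubFⁿ.⊆ᵇ⁺ n S W (λ v Sv → ^⊥^⊥⊆ W sW v
      (^⊥-antitone (W ^⊥) (S ^⊥) (SubFⁿ.⊆ᵇ⁻ n (W ^⊥) (S ^⊥) t) v (⊆^⊥^⊥ S v Sv))))
    (λ t → SubFⁿ.⊆ᵇ⁺ n (W ^⊥) (S ^⊥) (^⊥-antitone S W (SubFⁿ.⊆ᵇ⁻ n S W t)))

  ∙-nondegenerate : ∀ {n} (v : Vec Carrier n) → (∀ u → u ∙ v ≡ 0#) → v ≡ 0v
  ∙-nondegenerate Vec.[] _ = refl
  ∙-nondegenerate (a Vec.∷ v) ⊥all = cong₂ Vec._∷_ a≡0 (∙-nondegenerate v tail⊥)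
    where
    a≡0 : a ≡ 0#
    a≡0 = trans (sym (trans (cong₂ _+_ (R.*-identityˡ a) (∙-0ˡ v)) (R.+-identityʳ a))) (⊥all (1# Vec.∷ 0v))
    tail⊥ : ∀ u → u ∙ v ≡ 0#
    tail⊥ u = trans (sym (trans (cong (_+ u ∙ v) (R.zeroˡ a)) (R.+-identityˡ _))) (⊥all (0# Vec.∷ u))

  module SubMat (n m : ℕ) = Subspaces F (mzero F) (madd F) (mscale F) (Mat-laws n m) (VecP.≡-dec (VecP.≡-dec _≟_))
                                      (allVecsOf-isEnumeration (allVecsOf-isEnumeration elements-isEnumeration m) n)

  infixr 7 _*ᵥ_
  _*ᵥ_ : ∀ {n m} → Mat F n m → Vec Carrier m → Vec Carrier n
  _*ᵥ_ = _·ᵥ_ F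

  madd-*ᵥ : ∀ {n m} (X Y : Mat F n m) c → madd F X Y *ᵥ c ≡ X *ᵥ c ⊕ Y *ᵥ c
  madd-*ᵥ Vec.[] Vec.[] c = refl
  madd-*ᵥ (r Vec.∷ X) (s Vec.∷ Y) c = cong₂ Vec._∷_ (∙-⊕ˡ r s c) (madd-*ᵥ X Y c)

  mscale-*ᵥ : ∀ {n m} a (X : Mat F n m) c → mscale F a X *ᵥ c ≡ a · (X *ᵥ c)
  mscale-*ᵥ a Vec.[] c = refl
  mscale-*ᵥ a (r Vec.∷ X) c = cong₂ Vec._∷_ (∙-·ˡ a r c) (mscale-*ᵥ a X c)

  mzero-*ᵥ : ∀ {n m} (c : Vec Carrier m) → mzero F {n} *ᵥ c ≡ 0v
  mzero-*ᵥ {zero} c = refl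
  mzero-*ᵥ {suc n} c = cong₂ Vec._∷_ (∙-0ˡ c) (mzero-*ᵥ c)

  *ᵥ-⊕ : ∀ {n m} (X : Mat F n m) c c′ → X *ᵥ (c ⊕ c′) ≡ X *ᵥ c ⊕ X *ᵥ c′
  *ᵥ-⊕ Vec.[] c c′ = refl
  *ᵥ-⊕ (r Vec.∷ X) c c′ = cong₂ Vec._∷_ (∙-⊕ʳ r c c′) (*ᵥ-⊕ X c c′)

  *ᵥ-· : ∀ {n m} a (X : Mat F n m) c → X *ᵥ (a · c) ≡ a · (X *ᵥ c)
  *ᵥ-· a Vec.[] c = refl
  *ᵥ-· a (r Vec.∷ X) c = cong₂ Vec._∷_ (∙-·ʳ a r c) (*ᵥ-· a X c)

  *ᵥ-0v : ∀ {n m} (X : Mat F n m) → X *ᵥ 0v ≡ 0v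
  *ᵥ-0v Vec.[] = refl
  *ᵥ-0v (r Vec.∷ X) = cong₂ Vec._∷_ (∙-0ʳ r) (*ᵥ-0v X)

  *ᵥ-nondegenerate : ∀ {n m} (X : Mat F n m) → (∀ c → X *ᵥ c ≡ 0v) → X ≡ mzero F
  *ᵥ-nondegenerate Vec.[] _ = refl
  *ᵥ-nondegenerate (r Vec.∷ X) X·≡0 = cong₂ Vec._∷_
    (∙-nondegenerate r (λ c → trans (∙-comm c r) (cong Vec.head (X·≡0 c))))
    (*ᵥ-nondegenerate X (λ c → cong Vec.tail (X·≡0 c)))

  supp⁻ : ∀ {n m} (X : Mat F n m) {v} → T (supp F X v) → Σ (Vec Carrier m) (λ c → X *ᵥ c ≡ v)
  supp⁻ {n} {m} X t = let (c , Xc≡v) = anyB⁻ _ (allVecs F m) t in c , toWitness Xc≡v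

  supp⁺ : ∀ {n m} (X : Mat F n m) c → T (supp F X (X *ᵥ c))
  supp⁺ {n} {m} X c = anyB⁺ _ (SubFⁿ.∈allV m c) (fromWitness refl)

  supp-IsSubspace : ∀ {n m} (X : Mat F n m) → SubFⁿ.IsSubspace n (supp F X)
  supp-IsSubspace X = record
    { 0∈ = subst (λ v → T (supp F X v)) (*ᵥ-0v X) (supp⁺ X 0v)
    ; ⊕∈ = λ x y x∈ y∈ → let (c , Xc≡x) = supp⁻ X x∈ ; (c′ , Xc′≡y) = supp⁻ X y∈ in
        subst (λ v → T (supp F X v)) (trans (*ᵥ-⊕ X c c′) (cong₂ _⊕_ Xc≡x Xc′≡y)) (supp⁺ X (c ⊕ c′))
    ; ·∈ = λ a x x∈ → let (c , Xc≡x) = supp⁻ X x∈ in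
        subst (λ v → T (supp F X v)) (trans (*ᵥ-· a X c) (cong (a ·_) Xc≡x)) (supp⁺ X (a · c)) }

  suppIn : ∀ {n m} → E.Sub F n → M.Sub F n m
  suppIn {n} W X = E._⊆ᵇ_ F n (supp F X) W

  suppIn-IsSubspace : ∀ {n m} (W : E.Sub F n) → SubFⁿ.IsSubspace n W → SubMat.IsSubspace n m (suppIn W)
  suppIn-IsSubspace {n} {m} W sW = record
    { 0∈ = SubFⁿ.⊆ᵇ⁺ n _ W (λ v t → let (c , e) = supp⁻ (mzero F {n} {m}) t in
        subst (λ y → T (W y)) (trans (sym (mzero-*ᵥ c)) e) 0∈)
    ; ⊕∈ = λ X Y X∈ Y∈ → SubFⁿ.⊆ᵇ⁺ n _ W (λ v t → let (c , e) = supp⁻ (madd F X Y) t in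
        subst (λ y → T (W y)) (trans (sym (madd-*ᵥ X Y c)) e)
          (⊕∈ _ _ (SubFⁿ.⊆ᵇ⁻ n _ W X∈ _ (supp⁺ X c)) (SubFⁿ.⊆ᵇ⁻ n _ W Y∈ _ (supp⁺ Y c))))
    ; ·∈ = λ a X X∈ → SubFⁿ.⊆ᵇ⁺ n _ W (λ v t → let (c , e) = supp⁻ (mscale F a X) t in
        subst (λ y → T (W y)) (trans (sym (mscale-*ᵥ a X c)) e) (·∈ a _ (SubFⁿ.⊆ᵇ⁻ n _ W X∈ _ (supp⁺ X c)))) }
    where open SubFⁿ.IsSubspace n sW

  ⊞⁻ : ∀ {n} (P Q : E.Sub F n) v → T (_⊞_ F P Q v) → Σ (Vec Carrier n) (λ u → T (P u) × T (Q (v ⊖ u)))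
  ⊞⁻ {n} P Q v t = let (u , t′) = anyB⁻ _ (allVecs F n) t in
    u , proj₁ (T-∧⁻ t′) , subst (λ y → T (Q (v ⊕ y))) (vneg≡-1· u) (proj₂ (T-∧⁻ {P u} t′))

  ⊞⁺ : ∀ {n} (P Q : E.Sub F n) u w → T (P u) → T (Q w) → T (_⊞_ F P Q (u ⊕ w))
  ⊞⁺ {n} P Q u w Pu Qw = anyB⁺ _ (SubFⁿ.∈allV n u)
    (T-∧⁺ Pu (subst (λ y → T (Q y)) (sym (trans (cong ((u ⊕ w) ⊕_) (vneg≡-1· u)) u⊕w⊖u≡w)) Qw))
    where
    u⊕w⊖u≡w : (u ⊕ w) ⊖ u ≡ w
    u⊕w⊖u≡w = trans (cong (_⊖ u) (VL.⊕-comm u w)) (VL.⊕-⊖ w u)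

  ≡⊕⊖ : ∀ {n} (x u : Vec Carrier n) → x ≡ u ⊕ (x ⊖ u)
  ≡⊕⊖ x u = sym (trans (VL.⊕-comm u _) (VL.⊖-⊕ x u))

  ⊞-IsSubspace : ∀ {n} (P Q : E.Sub F n) → SubFⁿ.IsSubspace n P → SubFⁿ.IsSubspace n Q → SubFⁿ.IsSubspace n (_⊞_ F P Q)
  ⊞-IsSubspace {n} P Q sP sQ = record
    { 0∈ = subst (λ y → T (_⊞_ F P Q y)) (VL.⊕-identityˡ 0v) (⊞⁺ P Q _ _ (P.0∈) (Q.0∈))
    ; ⊕∈ = λ x y x∈ y∈ → let (u , Pu , Qx⊖u) = ⊞⁻ P Q x x∈ ; (u′ , Pu′ , Qy⊖u′) = ⊞⁻ P Q y y∈ in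
        subst (λ z → T (_⊞_ F P Q z))
              (sym (trans (cong₂ _⊕_ (≡⊕⊖ x u) (≡⊕⊖ y u′)) (VL.⊕-interchange u _ u′ _)))
          (⊞⁺ P Q _ _ (P.⊕∈ _ _ Pu Pu′) (Q.⊕∈ _ _ Qx⊖u Qy⊖u′))
    ; ·∈ = λ a x x∈ → let (u , Pu , Qx⊖u) = ⊞⁻ P Q x x∈ in
        subst (λ z → T (_⊞_ F P Q z)) (sym (trans (cong (a ·_) (≡⊕⊖ x u)) (VL.·-distribˡ a u _)))
          (⊞⁺ P Q _ _ (P.·∈ a _ Pu) (Q.·∈ a _ Qx⊖u)) }
    where
    module P = SubFⁿ.IsSubspace n sP
    module Q = SubFⁿ.IsSubspace n sQ

  ⊞-⊆ᵇ : ∀ {n} (P Q W : E.Sub F n) → SubFⁿ.IsSubspace n P → SubFⁿ.IsSubspace n Q → SubFⁿ.IsSubspace n W →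
         E._⊆ᵇ_ F n (_⊞_ F P Q) W ≡ (E._⊆ᵇ_ F n P W ∧ E._⊆ᵇ_ F n Q W)
  ⊞-⊆ᵇ {n} P Q W sP sQ sW = T-ext
    (λ t → T-∧⁺ (SubFⁿ.⊆ᵇ⁺ n P W (λ v Pv → SubFⁿ.⊆ᵇ⁻ n _ W t v
                   (subst (λ y → T (_⊞_ F P Q y)) (VL.⊕-identityʳ v) (⊞⁺ P Q _ _ Pv (SubFⁿ.IsSubspace.0∈ sQ)))))
                 (SubFⁿ.⊆ᵇ⁺ n Q W (λ v Qv → SubFⁿ.⊆ᵇ⁻ n _ W t v
                   (subst (λ y → T (_⊞_ F P Q y)) (VL.⊕-identityˡ v) (⊞⁺ P Q _ _ (SubFⁿ.IsSubspace.0∈ sP) Qv)))))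
    (λ t → SubFⁿ.⊆ᵇ⁺ n _ W (λ v v∈ → let (u , Pu , Qv⊖u) = ⊞⁻ P Q v v∈ in
       subst (λ y → T (W y)) (sym (≡⊕⊖ v u))
         (SubFⁿ.IsSubspace.⊕∈ sW _ _ (SubFⁿ.⊆ᵇ⁻ n P W (proj₁ (T-∧⁻ t)) _ Pu)
                                      (SubFⁿ.⊆ᵇ⁻ n Q W (proj₂ (T-∧⁻ {E._⊆ᵇ_ F n P W} t)) _ Qv⊖u))))

  zeroSub-IsSubspace : ∀ {n} → SubFⁿ.IsSubspace n (zeroSub F n)
  zeroSub-IsSubspace = record
    { 0∈ = fromWitness refl
    ; ⊕∈ = λ x y x≡0 y≡0 → fromWitness (trans (cong₂ _⊕_ (toWitness x≡0) (toWitness y≡0)) (VL.⊕-identityˡ 0v))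
    ; ·∈ = λ a x x≡0 → fromWitness (trans (cong (a ·_) (toWitness x≡0)) (VL.·-zeroʳ a)) }

  suppSum-IsSubspace : ∀ {n m t} (Xs : Vec (Mat F n m) t) → SubFⁿ.IsSubspace n (suppSum F Xs)
  suppSum-IsSubspace Vec.[] = zeroSub-IsSubspace
  suppSum-IsSubspace (X Vec.∷ Xs) = ⊞-IsSubspace _ _ (supp-IsSubspace X) (suppSum-IsSubspace Xs)

  suppSum-⊆ᵇ : ∀ {n m t} (Xs : Vec (Mat F n m) t) (W : E.Sub F n) → SubFⁿ.IsSubspace n W →
               E._⊆ᵇ_ F n (suppSum F Xs) W ≡ allB (suppIn W) (toList Xs)
  suppSum-⊆ᵇ {n} Vec.[] W sW =
    T⇒≡true (SubFⁿ.⊆ᵇ⁺ n _ W (λ v v≡0 → subst (λ y → T (W y)) (sym (toWitness v≡0)) (SubFⁿ.IsSubspace.0∈ sW)))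
  suppSum-⊆ᵇ (X Vec.∷ Xs) W sW =
    trans (⊞-⊆ᵇ _ _ W (supp-IsSubspace X) (suppSum-IsSubspace Xs) sW) (cong (suppIn W X ∧_) (suppSum-⊆ᵇ Xs W sW))

-- Hyperplane sections and the Möbius sum over an interval of subspaces

module Möbius (F : FiniteField) (n : ℕ) (dim : E.Sub F n → ℕ)
              (dim-spec : ∀ W → T (E.isSubspace F n W) → E.HasDim F n W (dim W)) where
  open Fⁿ F
  open SubFⁿ n

  ∣∣≡q^dim : ∀ {W} → IsSubspace W → ∣ W ∣ ≡ q ℕ.^ dim W
  ∣∣≡q^dim {W} sW = HasDim⇒∣∣≡q^ sW (dim W) (dim-spec W (isSubspace⁺ W sW))

  dim-cong : ∀ {A B} → IsSubspace A → IsSubspace B → (∀ v → A v ≡ B v) → dim A ≡ dim B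
  dim-cong sA sB A≗B = ^-injectiveʳ q≥2 _ _ (trans (sym (∣∣≡q^dim sA)) (trans (∣∣-cong A≗B) (∣∣≡q^dim sB)))

  dim-mono : ∀ {A B} → IsSubspace A → IsSubspace B → (∀ v → T (A v) → T (B v)) → dim A ≤ dim B
  dim-mono sA sB A⊆B = ^-cancelʳ-≤ q≥2 _ _ (subst₂ _≤_ (∣∣≡q^dim sA) (∣∣≡q^dim sB) (∣∣-mono A⊆B))

  module Hyperplane (u : Vec Carrier n) where

    level : Carrier → Sub
    level c x = ⌊ u ∙ x ≟ c ⌋

    ker : Sub
    ker = level 0#

    ker-IsSubspace : IsSubspace ker
    ker-IsSubspace = record
      { 0∈ = fromWitness (∙-0ʳ u)
      ; ⊕∈ = λ x y x∈ y∈ → fromWitness (trans (∙-⊕ʳ u x y)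
               (trans (cong₂ _+_ (toWitness x∈) (toWitness y∈)) (R.+-identityˡ 0#)))
      ; ·∈ = λ a x x∈ → fromWitness (trans (∙-·ʳ a u x) (trans (cong (a *_) (toWitness x∈)) (R.zeroʳ a))) }

    normalise : ∀ {A} → IsSubspace A → ∀ y → T (A y) → u ∙ y ≢ 0# →
                Σ (Vec Carrier n) (λ a → T (A a) × u ∙ a ≡ 1#)
    normalise sA y Ay u∙y≢0 = let (k , u∙y*k≡1) = inverse (u ∙ y) u∙y≢0 in
      k · y , IsSubspace.·∈ sA k y Ay , trans (∙-·ʳ k u y) (trans (R.*-comm k _) u∙y*k≡1)

    ⊈ker⇒level1 : ∀ {A} → IsSubspace A → ¬ T (A ⊆ᵇ ker) → Σ (Vec Carrier n) (λ a → T (A a) × u ∙ a ≡ 1#)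
    ⊈ker⇒level1 {A} sA A⊈ker = let (y , Ay , y∉ker) = ¬⊆ᵇ⁻ A ker A⊈ker in
      normalise sA y Ay (λ u∙y≡0 → y∉ker (fromWitness u∙y≡0))

    translate : ∀ {A} → IsSubspace A → ∀ {w} → T (A w) → ∀ x → A x ≡ A (x ⊕ w)
    translate {A} sA {w} Aw x = T-ext (λ Ax → IsSubspace.⊕∈ sA x w Ax Aw)
      (λ Ax⊕w → subst (λ y → T (A y)) (VL.⊕-⊖ x w) (IsSubspace.⊖∈ sA _ _ Ax⊕w Aw))

    -- Translation by c · a, where u ∙ a ≡ 1, maps A ∩ ker bijectively onto A ∩ level c.
    ∣∩level∣≡∣∩ker∣ : ∀ {A} → IsSubspace A → ∀ {a} → T (A a) → u ∙ a ≡ 1# →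
                      ∀ c → ∣ A ∩ level c ∣ ≡ ∣ A ∩ ker ∣
    ∣∩level∣≡∣∩ker∣ {A} sA {a} Aa u∙a≡1 c = sym (count-bijection (VecP.≡-dec _≟_) (VecP.≡-dec _≟_)
      allV-isEnumeration allV-isEnumeration (λ x → x ⊕ c · a) (λ y → y ⊖ c · a)
      (λ x → VL.⊕-⊖ x (c · a)) (λ y → VL.⊖-⊕ y (c · a)) (A ∩ ker) (A ∩ level c) shift)
      where
      u∙ca≡c : u ∙ (c · a) ≡ c
      u∙ca≡c = trans (∙-·ʳ c u a) (trans (cong (c *_) u∙a≡1) (R.*-identityʳ c))
      shift : ∀ x → (A ∩ ker) x ≡ (A ∩ level c) (x ⊕ c · a)
      shift x = cong₂ _∧_ (translate sA (IsSubspace.·∈ sA c a Aa) x)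
        (⌊⌋-cong (u ∙ x ≟ 0#) (u ∙ (x ⊕ c · a) ≟ c)
          (λ u∙x≡0 → trans (∙-⊕ʳ u x _) (trans (cong₂ _+_ u∙x≡0 u∙ca≡c) (R.+-identityˡ c)))
          (λ u∙x⊕ca≡c → begin
            u ∙ x
              ≡⟨ sym (CL.⊕-⊖ (u ∙ x) c) ⟩
            (u ∙ x + c) + ((- 1#) * c)
              ≡⟨ cong (λ d → (u ∙ x + d) + ((- 1#) * c)) (sym u∙ca≡c) ⟩
            (u ∙ x + u ∙ (c · a)) + ((- 1#) * c)
              ≡⟨ cong (_+ ((- 1#) * c)) (trans (sym (∙-⊕ʳ u x _)) u∙x⊕ca≡c) ⟩
            c + ((- 1#) * c)
              ≡⟨ CL.⊖-self c ⟩
            0# ∎))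
        where open ≡-Reasoning

    ∣∣≡q*∣∩ker∣ : ∀ {A} → IsSubspace A → ∀ {a} → T (A a) → u ∙ a ≡ 1# →
                  ∣ A ∣ ≡ q ℕ.* ∣ A ∩ ker ∣
    ∣∣≡q*∣∩ker∣ {A} sA Aa u∙a≡1 = begin
      ∣ A ∣
        ≡⟨ ℕ∑.∑-cong (allVecs F n) split-by-level ⟩
      ℕ∑.∑ (λ x → ℕ∑.∑ (λ c → ℕ∑.[ (A ∩ level c) x ]) elements) (allVecs F n)
        ≡⟨ ℕ∑.∑-swap _ (allVecs F n) elements ⟩
      ℕ∑.∑ (λ c → ∣ A ∩ level c ∣) elements
        ≡⟨ ℕ∑.∑-cong elements (∣∩level∣≡∣∩ker∣ sA Aa u∙a≡1) ⟩
      ℕ∑.∑ (λ _ → ∣ A ∩ ker ∣) elements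
        ≡⟨ ∑-const _ elements ⟩
      q ℕ.* ∣ A ∩ ker ∣ ∎
      where
      open ≡-Reasoning
      split-by-level : ∀ x → ℕ∑.[ A x ] ≡ ℕ∑.∑ (λ c → ℕ∑.[ (A ∩ level c) x ]) elements
      split-by-level x with A x
      ... | false = sym (ℕ∑.∑-zero elements (λ _ → refl))
      ... | true = sym (trans (ℕ∑.∑-cong elements (λ c → cong ℕ∑.[_] (⌊⌋-cong (u ∙ x ≟ c) (c ≟ u ∙ x) sym sym)))
                              (count-≟ _≟_ elements-isEnumeration (u ∙ x)))

    dim≡1+dim∩ker : ∀ {A} → IsSubspace A → ∀ {a} → T (A a) → u ∙ a ≡ 1# → dim A ≡ suc (dim (A ∩ ker))
    dim≡1+dim∩ker sA Aa u∙a≡1 = ^-injectiveʳ q≥2 _ _ (trans (sym (∣∣≡q^dim sA))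
      (trans (∣∣≡q*∣∩ker∣ sA Aa u∙a≡1) (cong (q ℕ.*_) (∣∣≡q^dim (∩-IsSubspace sA ker-IsSubspace)))))

  module Interval (X : Sub) (sX : IsSubspace X) where

    μX : Sub → ℤ
    μX A = möbiusCoeff q (dim A ∸ dim X)

    between : Sub → Sub → Bool
    between Y A = isSubspace A ∧ (X ⊆ᵇ A ∧ A ⊆ᵇ Y)

    between⁻ : ∀ Y A → T (between Y A) → IsSubspace A × T (X ⊆ᵇ A) × T (A ⊆ᵇ Y)
    between⁻ Y A t = let (s , XA∧AY) = T-∧⁻ t ; (XA , AY) = T-∧⁻ {X ⊆ᵇ A} XA∧AY in isSubspace⁻ A s , XA , AY

    between⁺ : ∀ Y A → IsSubspace A → T (X ⊆ᵇ A) → T (A ⊆ᵇ Y) → T (between Y A)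
    between⁺ Y A sA XA AY = T-∧⁺ (isSubspace⁺ A sA) (T-∧⁺ XA AY)

    ∑μ : Sub → ℤ
    ∑μ Y = ℤ∑.∑ (λ A → if between Y A then μX A else + 0) allSubsets

    ∑μ-not-above : ∀ Y → ¬ T (X ⊆ᵇ Y) → ∑μ Y ≡ + 0
    ∑μ-not-above Y X⊈Y = ℤ∑.∑-zero allSubsets vanish
      where
      vanish : ∀ A → (if between Y A then μX A else + 0) ≡ + 0
      vanish A with between Y A in eq
      ... | false = refl
      ... | true = let (_ , XA , AY) = between⁻ Y A (≡true⇒T eq) in ⊥-elim (X⊈Y (⊆ᵇ-trans X A Y XA AY))

    ∑μ-bottom : ∀ Y → T (X ⊆ᵇ Y) → T (Y ⊆ᵇ X) → ∑μ Y ≡ + 1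
    ∑μ-bottom Y XY YX = begin
      ∑μ Y
        ≡⟨ ℤ∑.∑-cong allSubsets (λ A → cong (λ b → if b then μX A else + 0) (between≡≗X A)) ⟩
      ℤ∑.∑ (λ A → if A ≗ᵇ X then μX A else + 0) allSubsets
        ≡⟨ ∑-allSubsets-δ ℤP.+-*-isSemiring X μX μX-resp ⟩
      μX X
        ≡⟨ cong (möbiusCoeff q) (ℕP.n∸n≡0 (dim X)) ⟩
      + 1 ∎
      where
      open ≡-Reasoning
      between≡≗X : ∀ A → between Y A ≡ (A ≗ᵇ X)
      between≡≗X A = T-ext
        (λ t → let (_ , XA , AY) = between⁻ Y A t in T-∧⁺ (⊆ᵇ-trans A Y X AY YX) XA)
        (λ t → let A≗X = ≗ᵇ⁻ A X t in
          between⁺ Y A (IsSubspace-resp A≗X sX) (proj₂ (T-∧⁻ {A ⊆ᵇ X} t)) (⊆ᵇ-trans A X Y (proj₁ (T-∧⁻ t)) XY))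
      μX-resp : ∀ A → T (A ≗ᵇ X) → μX A ≡ μX X
      μX-resp A t = let A≗X = ≗ᵇ⁻ A X t in
        cong (λ k → möbiusCoeff q (k ∸ dim X)) (dim-cong (IsSubspace-resp A≗X sX) sX A≗X)

    -- One step of the recursion: cut Y by a hyperplane ker u ⊇ X that misses the vector v ∈ Y.
    module Cut (Y : Sub) (sY : IsSubspace Y) (X⊆Y : T (X ⊆ᵇ Y)) (u : Vec Carrier n) (u⊥X : T ((X ^⊥) u))
               (v : Vec Carrier n) (Yv : T (Y v)) (u∙v≡1 : u ∙ v ≡ 1#) where
      open Hyperplane u

      Y′ : Sub
      Y′ = Y ∩ ker

      Y′-IsSubspace : IsSubspace Y′
      Y′-IsSubspace = ∩-IsSubspace sY ker-IsSubspace

      X⊆ker : ∀ x → T (X x) → T (ker x)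
      X⊆ker x Xx = fromWitness (trans (∙-comm u x) (^⊥⁻ X u⊥X x Xx))

      X⊆Y′ : T (X ⊆ᵇ Y′)
      X⊆Y′ = ⊆ᵇ⁺ X Y′ (λ x Xx → T-∧⁺ (⊆ᵇ⁻ X Y X⊆Y x Xx) (X⊆ker x Xx))

      dimY≡1+dimY′ : dim Y ≡ suc (dim Y′)
      dimY≡1+dimY′ = dim≡1+dim∩ker sY Yv u∙v≡1

      off-ker : Sub → Bool
      off-ker A = between Y A ∧ not (A ⊆ᵇ ker)

      ∑μ-off-ker : ℤ
      ∑μ-off-ker = ℤ∑.∑ (λ A → if off-ker A then μX A else + 0) allSubsets

      ∑μ-split : ∑μ Y ≡ ∑μ Y′ ℤ.+ ∑μ-off-ker
      ∑μ-split = trans (ℤ∑.∑-cong allSubsets split) (ℤ∑.∑-+ _ _ allSubsets)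
        where
        between-Y′ : ∀ A → between Y A ∧ (A ⊆ᵇ ker) ≡ between Y′ A
        between-Y′ A = begin
          (isSubspace A ∧ (X ⊆ᵇ A ∧ A ⊆ᵇ Y)) ∧ A ⊆ᵇ ker
            ≡⟨ BoolP.∧-assoc (isSubspace A) _ _ ⟩
          isSubspace A ∧ ((X ⊆ᵇ A ∧ A ⊆ᵇ Y) ∧ A ⊆ᵇ ker)
            ≡⟨ cong (isSubspace A ∧_) (BoolP.∧-assoc (X ⊆ᵇ A) _ _) ⟩
          isSubspace A ∧ (X ⊆ᵇ A ∧ (A ⊆ᵇ Y ∧ A ⊆ᵇ ker))
            ≡⟨ cong (λ b → isSubspace A ∧ (X ⊆ᵇ A ∧ b)) (sym (⊆ᵇ-∩ A Y ker)) ⟩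
          between Y′ A ∎
          where open ≡-Reasoning
        split : ∀ A → (if between Y A then μX A else + 0)
                      ≡ (if between Y′ A then μX A else + 0) ℤ.+ (if off-ker A then μX A else + 0)
        split A = trans (ℤ∑.if-∧-split (between Y A) (A ⊆ᵇ ker) (μX A))
                        (cong (λ b → (if b then μX A else + 0) ℤ.+ (if off-ker A then μX A else + 0)) (between-Y′ A))

      extends : Sub → Sub → Bool
      extends B A = (B ≗ᵇ (A ∩ ker)) ∧ off-ker A

      extends⁻ : ∀ B A → T (extends B A) →
                 (∀ y → B y ≡ (A ∩ ker) y) × IsSubspace A × T (X ⊆ᵇ A) × T (A ⊆ᵇ Y) × ¬ T (A ⊆ᵇ ker)
      extends⁻ B A t = let (B≗ , off) = T-∧⁻ t ; (btw , A⊈ker) = T-∧⁻ {between Y A} off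
                           (sA , XA , AY) = between⁻ Y A btw in
        ≗ᵇ⁻ B (A ∩ ker) B≗ , sA , XA , AY , T-not⁻ A⊈ker

      extends⇒between : ∀ B A → T (extends B A) → T (between Y′ B)
      extends⇒between B A t = let (B≗ , sA , XA , AY , _) = extends⁻ B A t in
        between⁺ Y′ B (IsSubspace-resp B≗ (∩-IsSubspace sA ker-IsSubspace))
          (⊆ᵇ⁺ X B (λ x Xx → subst T (sym (B≗ x)) (T-∧⁺ (⊆ᵇ⁻ X A XA x Xx) (X⊆ker x Xx))))
          (⊆ᵇ⁺ B Y′ (λ y By → let (Ay , y∈ker) = T-∧⁻ (subst T (B≗ y) By) in T-∧⁺ (⊆ᵇ⁻ A Y AY y Ay) y∈ker))

      μX-extends : ∀ B A → T (extends B A) → μX A ≡ (ℤ.- (+ (q ℕ.^ (dim B ∸ dim X)))) ℤ.* μX B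
      μX-extends B A t = trans (cong (möbiusCoeff q) dimA∸dimX) (möbiusCoeff-suc q (dim B ∸ dim X))
        where
        B≗ = proj₁ (extends⁻ B A t)
        sA = proj₁ (proj₂ (extends⁻ B A t))
        sB = IsSubspace-resp B≗ (∩-IsSubspace sA ker-IsSubspace)
        a = ⊈ker⇒level1 sA (proj₂ (proj₂ (proj₂ (proj₂ (extends⁻ B A t)))))
        dimA≡1+dimB : dim A ≡ suc (dim B)
        dimA≡1+dimB = trans (dim≡1+dim∩ker sA (proj₁ (proj₂ a)) (proj₂ (proj₂ a)))
                            (cong suc (sym (dim-cong sB (∩-IsSubspace sA ker-IsSubspace) B≗)))
        X⊆B : dim X ≤ dim B
        X⊆B = dim-mono sX sB (⊆ᵇ⁻ X B (proj₁ (proj₂ (between⁻ Y′ B (extends⇒between B A t)))))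
        dimA∸dimX : dim A ∸ dim X ≡ suc (dim B ∸ dim X)
        dimA∸dimX = trans (cong (_∸ dim X) dimA≡1+dimB) (ℕP.+-∸-assoc 1 X⊆B)

      extends-resp : ∀ B {A A′} → (∀ y → A y ≡ A′ y) → extends B A ≡ extends B A′
      extends-resp B {A} {A′} A≗A′ =
        cong₂ _∧_
          (cong₂ _∧_ (⊆ᵇ-respʳ B (A ∩ ker) (A′ ∩ ker) A∩≗A′∩) (⊆ᵇ-respˡ (A ∩ ker) (A′ ∩ ker) B A∩≗A′∩))
          (cong₂ _∧_
            (cong₂ _∧_ (isSubspace-resp A≗A′) (cong₂ _∧_ (⊆ᵇ-respʳ X A A′ A≗A′) (⊆ᵇ-respˡ A A′ Y A≗A′)))
                     (cong not (⊆ᵇ-respˡ A A′ ker A≗A′)))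
        where
        A∩≗A′∩ : ∀ y → (A ∩ ker) y ≡ (A′ ∩ ker) y
        A∩≗A′∩ y = cong (_∧ ker y) (A≗A′ y)

      module Extensions (B : Sub) (B∈[X,Y′] : T (between Y′ B)) where
        sB = proj₁ (between⁻ Y′ B B∈[X,Y′])
        X⊆B = proj₁ (proj₂ (between⁻ Y′ B B∈[X,Y′]))
        B⊆Y′ = proj₂ (proj₂ (between⁻ Y′ B B∈[X,Y′]))

        B⊆Y : ∀ y → T (B y) → T (Y y)
        B⊆Y y By = proj₁ (T-∧⁻ (⊆ᵇ⁻ B Y′ B⊆Y′ y By))

        B⊆ker : ∀ y → T (B y) → u ∙ y ≡ 0#
        B⊆ker y By = toWitness (proj₂ (T-∧⁻ {Y y} (⊆ᵇ⁻ B Y′ B⊆Y′ y By)))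

        -- For x ∈ Y ∩ level 1#, the only extension of B through x is the preimage of B under
        -- the projection π onto ker along x.
        module Through (x : Vec Carrier n) (Yx : T (Y x)) (u∙x≡1 : u ∙ x ≡ 1#) where

          π : Vec Carrier n → Vec Carrier n
          π y = y ⊖ (u ∙ y) · x

          π-⊕ : ∀ y₁ y₂ → π (y₁ ⊕ y₂) ≡ π y₁ ⊕ π y₂
          π-⊕ y₁ y₂ = begin
            (y₁ ⊕ y₂) ⊕ (- 1#) · ((u ∙ (y₁ ⊕ y₂)) · x)
              ≡⟨ cong (λ c → (y₁ ⊕ y₂) ⊕ (- 1#) · (c · x)) (∙-⊕ʳ u y₁ y₂) ⟩
            (y₁ ⊕ y₂) ⊕ (- 1#) · ((u ∙ y₁ + u ∙ y₂) · x)
              ≡⟨ cong (λ w → (y₁ ⊕ y₂) ⊕ (- 1#) · w) (VL.·-distribʳ (u ∙ y₁) (u ∙ y₂) x) ⟩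
            (y₁ ⊕ y₂) ⊕ (- 1#) · ((u ∙ y₁) · x ⊕ (u ∙ y₂) · x)
              ≡⟨ cong ((y₁ ⊕ y₂) ⊕_) (VL.·-distribˡ (- 1#) _ _) ⟩
            (y₁ ⊕ y₂) ⊕ ((- 1#) · (u ∙ y₁) · x ⊕ (- 1#) · (u ∙ y₂) · x)
              ≡⟨ VL.⊕-interchange y₁ y₂ _ _ ⟩
            π y₁ ⊕ π y₂ ∎
            where open ≡-Reasoning

          π-· : ∀ c y → π (c · y) ≡ c · π y
          π-· c y = begin
            c · y ⊕ (- 1#) · ((u ∙ (c · y)) · x)
              ≡⟨ cong (λ d → c · y ⊕ (- 1#) · (d · x)) (∙-·ʳ c u y) ⟩
            c · y ⊕ (- 1#) · ((c * d) · x)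
              ≡⟨ cong (c · y ⊕_) (VL.·-assoc (- 1#) _ x) ⟩
            c · y ⊕ ((- 1#) * (c * d)) · x
              ≡⟨ cong (λ k → c · y ⊕ k · x) (-1*-comm d) ⟩
            c · y ⊕ (c * ((- 1#) * d)) · x
              ≡⟨ cong (c · y ⊕_) (sym (VL.·-assoc c _ x)) ⟩
            c · y ⊕ c · (((- 1#) * d) · x)
              ≡⟨ cong (λ w → c · y ⊕ c · w) (sym (VL.·-assoc (- 1#) d x)) ⟩
            c · y ⊕ c · ((- 1#) · (d · x))
              ≡⟨ sym (VL.·-distribˡ c y _) ⟩
            c · π y ∎
            where
            open ≡-Reasoning
            d = u ∙ y
            -1*-comm : ∀ e → (- 1#) * (c * e) ≡ c * ((- 1#) * e)
            -1*-comm e = trans (sym (R.*-assoc (- 1#) c e)) (trans (cong (_* e) (R.*-comm (- 1#) c)) (R.*-assoc c (- 1#) e))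

          π-ker : ∀ y → u ∙ y ≡ 0# → π y ≡ y
          π-ker y u∙y≡0 = begin
            y ⊕ (- 1#) · ((u ∙ y) · x)   ≡⟨ cong (λ d → y ⊕ (- 1#) · (d · x)) u∙y≡0 ⟩
            y ⊕ (- 1#) · (0# · x)        ≡⟨ cong (λ w → y ⊕ (- 1#) · w) (VL.·-zero x) ⟩
            y ⊕ (- 1#) · 0v              ≡⟨ cong (y ⊕_) (VL.·-zeroʳ (- 1#)) ⟩
            y ⊕ 0v                       ≡⟨ VL.⊕-identityʳ y ⟩
            y                            ∎
            where open ≡-Reasoning

          π∈ker : ∀ y → u ∙ π y ≡ 0#
          π∈ker y = trans (∙-⊖ʳ u y _) (trans (cong (λ k → u ∙ y + ((- 1#) * k))
            (trans (∙-·ʳ (u ∙ y) u x) (trans (cong (u ∙ y *_) u∙x≡1) (R.*-identityʳ (u ∙ y))))) (x+-1*x≡0 (u ∙ y)))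

          π-x : π x ≡ 0v
          π-x = trans (cong (λ d → x ⊕ (- 1#) · (d · x)) u∙x≡1)
                      (trans (cong (λ w → x ⊕ (- 1#) · w) (VL.·-identity x)) (VL.⊖-self x))

          D : Sub
          D y = B (π y)

          D-IsSubspace : IsSubspace D
          D-IsSubspace = record
            { 0∈ = subst (λ w → T (B w)) (sym (π-ker 0v (∙-0ʳ u))) (IsSubspace.0∈ sB)
            ; ⊕∈ = λ y₁ y₂ D₁ D₂ → subst (λ w → T (B w)) (sym (π-⊕ y₁ y₂)) (IsSubspace.⊕∈ sB _ _ D₁ D₂)
            ; ·∈ = λ c y Dy → subst (λ w → T (B w)) (sym (π-· c y)) (IsSubspace.·∈ sB c _ Dy) }

          Dx : T (D x)
          Dx = subst (λ w → T (B w)) (sym π-x) (IsSubspace.0∈ sB)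

          D-extends : T (extends B D ∧ (D ∩ level 1#) x)
          D-extends = T-∧⁺
            (T-∧⁺ (≗ᵇ⁺ B (D ∩ ker) B≗D∩ker) (T-∧⁺ (between⁺ Y D D-IsSubspace X⊆D D⊆Y) (T-not⁺ D⊈ker)))
                           (T-∧⁺ Dx (fromWitness u∙x≡1))
            where
            B≗D∩ker : ∀ y → B y ≡ (D ∩ ker) y
            B≗D∩ker y = T-ext
              (λ By → T-∧⁺ (subst (λ w → T (B w)) (sym (π-ker y (B⊆ker y By))) By) (fromWitness (B⊆ker y By)))
              (λ t → let (Dy , y∈ker) = T-∧⁻ {D y} t in subst (λ w → T (B w)) (π-ker y (toWitness y∈ker)) Dy)
            X⊆D : T (X ⊆ᵇ D)
            X⊆D = ⊆ᵇ⁺ X D (λ y Xy →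
              subst (λ w → T (B w)) (sym (π-ker y (toWitness (X⊆ker y Xy)))) (⊆ᵇ⁻ X B X⊆B y Xy))
            D⊆Y : T (D ⊆ᵇ Y)
            D⊆Y = ⊆ᵇ⁺ D Y (λ y Dy → subst (λ w → T (Y w)) (VL.⊖-⊕ y _)
                                       (IsSubspace.⊕∈ sY _ _ (B⊆Y _ Dy) (IsSubspace.·∈ sY _ x Yx)))
            D⊈ker : ¬ T (D ⊆ᵇ ker)
            D⊈ker t = 0≢1 (trans (sym (toWitness (⊆ᵇ⁻ D ker t x Dx))) u∙x≡1)

          extends⇒≗D : ∀ A → T (extends B A ∧ (A ∩ level 1#) x) → ∀ y → A y ≡ D y
          extends⇒≗D A t y = T-ext A⊆D D⊆A
            where
            ext = proj₁ (T-∧⁻ t)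
            B≗ = proj₁ (extends⁻ B A ext)
            sA = proj₁ (proj₂ (extends⁻ B A ext))
            Ax = proj₁ (T-∧⁻ (proj₂ (T-∧⁻ {extends B A} t)))
            A⊆D : T (A y) → T (D y)
            A⊆D Ay = subst T (sym (B≗ (π y)))
              (T-∧⁺ (IsSubspace.⊖∈ sA _ _ Ay (IsSubspace.·∈ sA _ x Ax)) (fromWitness (π∈ker y)))
            D⊆A : T (D y) → T (A y)
            D⊆A Dy = subst (λ w → T (A w)) (VL.⊖-⊕ y _)
              (IsSubspace.⊕∈ sA _ _ (proj₁ (T-∧⁻ (subst T (B≗ (π y)) Dy))) (IsSubspace.·∈ sA _ x Ax))

          extends-through≡≗D : ∀ A → (extends B A ∧ (A ∩ level 1#) x) ≡ (A ≗ᵇ D)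
          extends-through≡≗D A = T-ext
            (λ t → ≗ᵇ⁺ A D (extends⇒≗D A t))
            (λ t → let A≗D = ≗ᵇ⁻ A D t in
              subst T (sym (cong₂ _∧_ (extends-resp B A≗D) (cong (_∧ level 1# x) (A≗D x)))) D-extends)

        #extends-through : ∀ x → count (λ A → extends B A ∧ (A ∩ level 1#) x) allSubsets ≡ ℕ∑.[ (Y ∩ level 1#) x ]
        #extends-through x with (Y ∩ level 1#) x in x∈
        ... | true = unique-extension (T-∧⁻ (≡true⇒T x∈))
          where
          unique-extension : T (Y x) × T (level 1# x) → count (λ A → extends B A ∧ (A ∩ level 1#) x) allSubsets ≡ 1
          unique-extension (Yx , u∙x≡1) =
            trans (ℕ∑.∑-cong allSubsets (λ A → cong ℕ∑.[_] (Through.extends-through≡≗D x Yx (toWitness u∙x≡1) A)))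
                  (∑-allSubsets-δ ℕP.+-*-isSemiring (Through.D x Yx (toWitness u∙x≡1)) (λ _ → 1) (λ _ _ → refl))
        ... | false = ℕ∑.∑-zero allSubsets vanish
          where
          vanish : ∀ A → ℕ∑.[ extends B A ∧ (A ∩ level 1#) x ] ≡ 0
          vanish A with extends B A ∧ (A ∩ level 1#) x in t
          ... | false = refl
          ... | true = let (ext , Ax∧lvl) = T-∧⁻ (≡true⇒T t) ; (Ax , lvl) = T-∧⁻ {A x} Ax∧lvl
                           A⊆Y = proj₁ (proj₂ (proj₂ (proj₂ (extends⁻ B A ext)))) in
            ⊥-elim (≡false⇒¬T x∈ (T-∧⁺ (⊆ᵇ⁻ A Y A⊆Y x Ax) lvl))

        -- Double counting of the pairs (A, x) with A extending B and x ∈ A ∩ level 1#.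
        #extends : count (extends B) allSubsets ≡ q ℕ.^ (dim Y′ ∸ dim B)
        #extends = *-^-cancelʳ q≥2 _ (dim B) (dim Y′) dimB≤dimY′ (begin
          #ext ℕ.* q ℕ.^ dim B
            ≡⟨ cong (#ext ℕ.*_) (sym (∣∣≡q^dim sB)) ⟩
          #ext ℕ.* ∣ B ∣
            ≡⟨ ℕP.*-comm #ext ∣ B ∣ ⟩
          ∣ B ∣ ℕ.* #ext
            ≡⟨ sym (ℕ∑.∑-*ˡ ∣ B ∣ _ allSubsets) ⟩
          ℕ∑.∑ (λ A → ∣ B ∣ ℕ.* ℕ∑.[ extends B A ]) allSubsets
            ≡⟨ ℕ∑.∑-cong allSubsets per-extension ⟩
          ℕ∑.∑ (λ A → count (λ x → extends B A ∧ (A ∩ level 1#) x) (allVecs F n)) allSubsets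
            ≡⟨ ℕ∑.∑-swap _ allSubsets (allVecs F n) ⟩
          ℕ∑.∑ (λ x → count (λ A → extends B A ∧ (A ∩ level 1#) x) allSubsets) (allVecs F n)
            ≡⟨ ℕ∑.∑-cong (allVecs F n) #extends-through ⟩
          ∣ Y ∩ level 1# ∣
            ≡⟨ ∣∩level∣≡∣∩ker∣ sY Yv u∙v≡1 1# ⟩
          ∣ Y′ ∣
            ≡⟨ ∣∣≡q^dim Y′-IsSubspace ⟩
          q ℕ.^ dim Y′ ∎)
          where
          open ≡-Reasoning
          #ext = count (extends B) allSubsets
          dimB≤dimY′ : dim B ≤ dim Y′
          dimB≤dimY′ = dim-mono sB Y′-IsSubspace (⊆ᵇ⁻ B Y′ B⊆Y′)
          per-extension : ∀ A → ∣ B ∣ ℕ.* ℕ∑.[ extends B A ]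
                                ≡ count (λ x → extends B A ∧ (A ∩ level 1#) x) (allVecs F n)
          per-extension A with extends B A in t
          ... | false = trans (ℕP.*-zeroʳ ∣ B ∣) (sym (ℕ∑.∑-zero (allVecs F n) (λ _ → refl)))
          ... | true = let (B≗ , sA , _ , _ , A⊈ker) = extends⁻ B A (≡true⇒T t)
                           (a , Aa , u∙a≡1) = ⊈ker⇒level1 sA A⊈ker in
            trans (ℕP.*-identityʳ ∣ B ∣) (trans (∣∣-cong B≗) (sym (∣∩level∣≡∣∩ker∣ sA Aa u∙a≡1 1#)))

      ∑-extends : ∀ B → ℤ∑.∑ (λ A → if extends B A then μX A else + 0) allSubsets
                        ≡ (if between Y′ B then (ℤ.- (+ (q ℕ.^ (dim Y′ ∸ dim X)))) ℤ.* μX B else + 0)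
      ∑-extends B with between Y′ B in B∈
      ... | false = ℤ∑.∑-zero allSubsets vanish
        where
        vanish : ∀ A → (if extends B A then μX A else + 0) ≡ + 0
        vanish A with extends B A in t
        ... | false = refl
        ... | true = ⊥-elim (≡false⇒¬T B∈ (extends⇒between B A (≡true⇒T t)))
      ... | true = begin
        ℤ∑.∑ (λ A → if extends B A then μX A else + 0) allSubsets
          ≡⟨ ℤ∑.∑-cong allSubsets constant-on-extensions ⟩
        ℤ∑.∑ (λ A → c ℤ.* ℤ∑.[ extends B A ]) allSubsets
          ≡⟨ ℤ∑.∑-*ˡ c _ allSubsets ⟩
        c ℤ.* ℤ∑.∑ (λ A → ℤ∑.[ extends B A ]) allSubsets
          ≡⟨ cong (c ℤ.*_) (trans (ℤ∑.∑-cong allSubsets (λ A → sym (+-[] (extends B A)))) (sym (+-∑ _ allSubsets))) ⟩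
        c ℤ.* (+ count (extends B) allSubsets)
          ≡⟨ cong (λ k → c ℤ.* (+ k)) (Extensions.#extends B (≡true⇒T B∈)) ⟩
        c ℤ.* (+ (q ℕ.^ (dim Y′ ∸ dim B)))
          ≡⟨ solve 3 (λ a μ b → ((:- a) :* μ) :* b := (:- (a :* b)) :* μ) refl
                   (+ (q ℕ.^ (dim B ∸ dim X))) (μX B) (+ (q ℕ.^ (dim Y′ ∸ dim B))) ⟩
        (ℤ.- ((+ (q ℕ.^ (dim B ∸ dim X))) ℤ.* (+ (q ℕ.^ (dim Y′ ∸ dim B))))) ℤ.* μX B
          ≡⟨ cong (λ k → (ℤ.- k) ℤ.* μX B) (trans (sym (ℤP.pos-* (q ℕ.^ (dim B ∸ dim X)) (q ℕ.^ (dim Y′ ∸ dim B))))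
               (cong +_ (trans (sym (ℕP.^-distribˡ-+-* q (dim B ∸ dim X) (dim Y′ ∸ dim B)))
                               (cong (q ℕ.^_) (∸-+-∸ X≤B B≤Y′))))) ⟩
        (ℤ.- (+ (q ℕ.^ (dim Y′ ∸ dim X)))) ℤ.* μX B ∎
        where
        open ≡-Reasoning
        open +-*-Solver
        c = (ℤ.- (+ (q ℕ.^ (dim B ∸ dim X)))) ℤ.* μX B
        constant-on-extensions : ∀ A → (if extends B A then μX A else + 0) ≡ c ℤ.* ℤ∑.[ extends B A ]
        constant-on-extensions A with extends B A in t
        ... | true = trans (μX-extends B A (≡true⇒T t)) (sym (ℤP.*-identityʳ c))
        ... | false = sym (ℤP.*-zeroʳ c)
        B-facts = between⁻ Y′ B (≡true⇒T B∈)
        X≤B : dim X ≤ dim B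
        X≤B = dim-mono sX (proj₁ B-facts) (⊆ᵇ⁻ X B (proj₁ (proj₂ B-facts)))
        B≤Y′ : dim B ≤ dim Y′
        B≤Y′ = dim-mono (proj₁ B-facts) Y′-IsSubspace (⊆ᵇ⁻ B Y′ (proj₂ (proj₂ B-facts)))

      -- Sort the subspaces A ⊈ ker by their hyperplane section B = A ∩ ker.
      ∑μ-off-ker≡ : ∑μ-off-ker ≡ (ℤ.- (+ (q ℕ.^ (dim Y′ ∸ dim X)))) ℤ.* ∑μ Y′
      ∑μ-off-ker≡ = begin
        ℤ∑.∑ (λ A → if off-ker A then μX A else + 0) allSubsets
          ≡⟨ ℤ∑.∑-cong allSubsets (λ A →
               sym (∑-allSubsets-δ ℤP.+-*-isSemiring (A ∩ ker) (λ _ → term A) (λ _ _ → refl))) ⟩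
        ℤ∑.∑ (λ A → ℤ∑.∑ (λ B → if B ≗ᵇ (A ∩ ker) then term A else + 0) allSubsets) allSubsets
          ≡⟨ ℤ∑.∑-swap _ allSubsets allSubsets ⟩
        ℤ∑.∑ (λ B → ℤ∑.∑ (λ A → if B ≗ᵇ (A ∩ ker) then term A else + 0) allSubsets) allSubsets
          ≡⟨ ℤ∑.∑-cong allSubsets (λ B →
               trans (ℤ∑.∑-cong allSubsets (λ A → ℤ∑.if-if≡if-∧ (B ≗ᵇ (A ∩ ker)) (off-ker A) (μX A))) (∑-extends B)) ⟩
        ℤ∑.∑ (λ B → if between Y′ B then c ℤ.* μX B else + 0) allSubsets
          ≡⟨ ℤ∑.∑-cong allSubsets (λ B → ℤ∑.if-then-*ˡ (between Y′ B) c (μX B)) ⟩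
        ℤ∑.∑ (λ B → c ℤ.* (if between Y′ B then μX B else + 0)) allSubsets
          ≡⟨ ℤ∑.∑-*ˡ c _ allSubsets ⟩
        c ℤ.* ∑μ Y′ ∎
        where
        open ≡-Reasoning
        c = ℤ.- (+ (q ℕ.^ (dim Y′ ∸ dim X)))
        term : Sub → ℤ
        term A = if off-ker A then μX A else + 0

    ∑μ-proper : ∀ Y → IsSubspace Y → T (X ⊆ᵇ Y) → ¬ T (Y ⊆ᵇ X) →
                Σ Sub (λ Y′ → IsSubspace Y′ × T (X ⊆ᵇ Y′) × dim Y ≡ suc (dim Y′) ×
                              ∑μ Y ≡ ∑μ Y′ ℤ.+ (ℤ.- (+ (q ℕ.^ (dim Y′ ∸ dim X)))) ℤ.* ∑μ Y′)
    ∑μ-proper Y sY X⊆Y Y⊈X =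
      Y′ , Y′-IsSubspace , X⊆Y′ , dimY≡1+dimY′ , trans ∑μ-split (cong (ℤ._+_ (∑μ Y′)) ∑μ-off-ker≡)
      where
      y,Yy,y∉X = ¬⊆ᵇ⁻ Y X Y⊈X
      y = proj₁ y,Yy,y∉X
      separator = separating-vector n X sX y (proj₂ (proj₂ y,Yy,y∉X))
      u = proj₁ separator
      v,Yv,u∙v≡1 = Hyperplane.normalise u sY y (proj₁ (proj₂ y,Yy,y∉X)) (proj₂ (proj₂ separator))
      open Cut Y sY X⊆Y u (proj₁ (proj₂ separator))
               (proj₁ v,Yv,u∙v≡1) (proj₁ (proj₂ v,Yv,u∙v≡1)) (proj₂ (proj₂ v,Yv,u∙v≡1))

    ∑μ≡δ : ∀ d Y → IsSubspace Y → dim Y ≡ d → ∑μ Y ≡ (if X ⊆ᵇ Y ∧ Y ⊆ᵇ X then + 1 else + 0)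
    ∑μ≡δ d Y sY dimY≡d with X ⊆ᵇ Y in XY | Y ⊆ᵇ X in YX
    ... | false | _ = ∑μ-not-above Y (≡false⇒¬T XY)
    ... | true | true = ∑μ-bottom Y (≡true⇒T XY) (≡true⇒T YX)
    ... | true | false with ∑μ-proper Y sY (≡true⇒T XY) (≡false⇒¬T YX) | d
    ...   | Y′ , sY′ , X⊆Y′ , dimY≡1+dimY′ , split | zero = ⊥-elim (ℕP.1+n≢0 (trans (sym dimY≡1+dimY′) dimY≡d))
    ...   | Y′ , sY′ , X⊆Y′ , dimY≡1+dimY′ , split | suc d′ =
      trans split (cancel (Y′ ⊆ᵇ X) refl)
      where
      IH = ∑μ≡δ d′ Y′ sY′ (ℕP.suc-injective (trans (sym dimY≡1+dimY′) dimY≡d))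
      c = ℤ.- (+ (q ℕ.^ (dim Y′ ∸ dim X)))
      cancel : ∀ b → Y′ ⊆ᵇ X ≡ b → ∑μ Y′ ℤ.+ c ℤ.* ∑μ Y′ ≡ + 0
      cancel false Y′⊈X = trans (cong (λ s → s ℤ.+ c ℤ.* s) ∑μY′≡0) (trans (ℤP.+-identityˡ _) (ℤP.*-zeroʳ c))
        where
        ∑μY′≡0 : ∑μ Y′ ≡ + 0
        ∑μY′≡0 = trans IH (cong (λ b → if b then + 1 else + 0) (cong₂ _∧_ (T⇒≡true X⊆Y′) Y′⊈X))
      cancel true Y′⊆X = trans (cong (λ s → s ℤ.+ c ℤ.* s) ∑μY′≡1)
                               (cong (λ k → + 1 ℤ.+ (ℤ.- (+ (q ℕ.^ k))) ℤ.* + 1) dimY′∸dimX≡0)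
        where
        ∑μY′≡1 : ∑μ Y′ ≡ + 1
        ∑μY′≡1 = trans IH (cong (λ b → if b then + 1 else + 0) (cong₂ _∧_ (T⇒≡true X⊆Y′) Y′⊆X))
        dimY′∸dimX≡0 : dim Y′ ∸ dim X ≡ 0
        dimY′∸dimX≡0 = trans (cong (_∸ dim X) (dim-cong sY′ sX (λ w → T-ext (⊆ᵇ⁻ Y′ X (≡true⇒T Y′⊆X) w)
                                                                            (⊆ᵇ⁻ X Y′ X⊆Y′ w))))
                             (ℕP.n∸n≡0 (dim X))

-- The contraction M[C].U

module Contraction (F : FiniteField) (n m k t : ℕ)
    (C : M.Sub F n m) (C-isSubspace : T (M.isSubspace F n m C)) (C-dim : M.HasDim F n m C k)
    (dimE : E.Sub F n → ℕ) (dimE-spec : ∀ W → T (E.isSubspace F n W) → E.HasDim F n W (dimE W))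
    (dimM : M.Sub F n m → ℕ) (dimM-spec : ∀ S → T (M.isSubspace F n m S) → M.HasDim F n m S (dimM S))
    (U : E.Sub F n) (U-isSubspace : T (E.isSubspace F n U)) where
  open Fⁿ F
  open QMatroid F {n} {m} {k} C dimE dimM
  module SubE = SubFⁿ n
  module SubM = SubMat n m
  open SubE using (allSubsets; isSubspace; _⊆ᵇ_; _≗ᵇ_)

  sU : SubE.IsSubspace U
  sU = SubE.isSubspace⁻ U U-isSubspace

  sC : SubM.IsSubspace C
  sC = SubM.isSubspace⁻ C C-isSubspace

  open Möbius F n dimE dimE-spec using (module Interval)
  open Interval (U ^⊥) (^⊥-IsSubspace U)

  tuples : List (Vec (Mat F n m) t)
  tuples = allVecsOf (allMats F n m) t

  inC : Vec (Mat F n m) t → Bool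
  inC Xs = allB C (toList Xs)

  C[]-IsSubspace : ∀ A → SubM.IsSubspace (C[ A ])
  C[]-IsSubspace A = SubM.∩-IsSubspace sC (suppIn-IsSubspace (A ^⊥) (^⊥-IsSubspace A))

  ∣C[]∣≡q^dimM : ∀ A → SubM.∣ C[ A ] ∣ ≡ q ℕ.^ dimM (C[ A ])
  ∣C[]∣≡q^dimM A = SubM.HasDim⇒∣∣≡q^ (C[]-IsSubspace A) _ (dimM-spec _ (SubM.isSubspace⁺ _ (C[]-IsSubspace A)))

  -- Only the zero matrix has its support inside E^⊥ = 0.
  dimM-C[E]≡0 : dimM (C[ whole F n ]) ≡ 0
  dimM-C[E]≡0 = ^-injectiveʳ q≥2 _ 0 (trans (sym (∣C[]∣≡q^dimM (whole F n))) (begin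
    SubM.∣ C[ whole F n ] ∣
      ≡⟨ SubM.∣∣-cong C[E]≡zero ⟩
    count (λ X → ⌊ VecP.≡-dec (VecP.≡-dec _≟_) X (mzero F) ⌋) (allMats F n m)
      ≡⟨ count-≟ (VecP.≡-dec (VecP.≡-dec _≟_)) SubM.allV-isEnumeration (mzero F) ⟩
    1 ∎))
    where
    open ≡-Reasoning
    C[E]≡zero : ∀ X → C[ whole F n ] X ≡ ⌊ VecP.≡-dec (VecP.≡-dec _≟_) X (mzero F) ⌋
    C[E]≡zero X = T-ext
      (λ t → fromWitness (*ᵥ-nondegenerate X (λ c → ∙-nondegenerate _ (λ u →
        ^⊥⁻ (whole F n) (SubE.⊆ᵇ⁻ (supp F X) (whole F n ^⊥) (proj₂ (T-∧⁻ {C X} t)) _ (supp⁺ X c)) u tt))))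
      (λ t → subst (λ Y → T (C[ whole F n ] Y)) (sym (toWitness t)) (SubM.IsSubspace.0∈ (C[]-IsSubspace (whole F n))))

  dimM-C[]-antitone : ∀ A B → (∀ v → T (A v) → T (B v)) → dimM (C[ B ]) ≤ dimM (C[ A ])
  dimM-C[]-antitone A B A⊆B =
    ^-cancelʳ-≤ q≥2 _ _ (subst₂ _≤_ (∣C[]∣≡q^dimM B) (∣C[]∣≡q^dimM A) (SubM.∣∣-mono C[B]⊆C[A]))
    where
    C[B]⊆C[A] : ∀ X → T (C[ B ] X) → T (C[ A ] X)
    C[B]⊆C[A] X t = let (CX , suppX⊆B^⊥) = T-∧⁻ {C X} t in
      T-∧⁺ CX (SubE.⊆ᵇ⁺ (supp F X) (A ^⊥) (λ v v∈ →
        ^⊥-antitone A B A⊆B v (SubE.⊆ᵇ⁻ (supp F X) (B ^⊥) suppX⊆B^⊥ v v∈)))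

  dimM-C[]≤k : ∀ A → dimM (C[ A ]) ≤ k
  dimM-C[]≤k A = ^-cancelʳ-≤ q≥2 _ _ (subst₂ _≤_ (∣C[]∣≡q^dimM A) (SubM.HasDim⇒∣∣≡q^ sC k C-dim)
                                              (SubM.∣∣-mono (λ X t → proj₁ (T-∧⁻ t))))

  -- Unfolding ρ(T) = k ∸ dim C_T; all truncated subtractions are exact by the two bounds above.
  exponent≡dimM : ∀ A → T (E._⊆ᵇ_ F n (U ^⊥) A) → ρ[ U ^⊥ ] (whole F n) ∸ ρ[ U ^⊥ ] A ≡ dimM (C[ A ])
  exponent≡dimM A U^⊥⊆A = begin
    ((k ∸ dimM (C[ whole F n ])) ∸ (k ∸ a)) ∸ ((k ∸ b) ∸ (k ∸ a))
      ≡⟨ cong (λ w → ((k ∸ w) ∸ (k ∸ a)) ∸ ((k ∸ b) ∸ (k ∸ a))) dimM-C[E]≡0 ⟩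
    (k ∸ (k ∸ a)) ∸ ((k ∸ b) ∸ (k ∸ a))
      ≡⟨ cong₂ _∸_ (ℕP.m∸[m∸n]≡n a≤k) [k∸b]∸[k∸a]≡a∸b ⟩
    a ∸ (a ∸ b)
      ≡⟨ ℕP.m∸[m∸n]≡n b≤a ⟩
    b ∎
    where
    open ≡-Reasoning
    a = dimM (C[ U ^⊥ ])
    b = dimM (C[ A ])
    a≤k = dimM-C[]≤k (U ^⊥)
    b≤a = dimM-C[]-antitone (U ^⊥) A (SubE.⊆ᵇ⁻ (U ^⊥) A U^⊥⊆A)
    [k∸b]∸[k∸a]≡a∸b : (k ∸ b) ∸ (k ∸ a) ≡ a ∸ b
    [k∸b]∸[k∸a]≡a∸b = ℕP.+-cancelʳ-≡ (k ∸ a) _ _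
      (trans (ℕP.m∸n+n≡m (ℕP.∸-monoʳ-≤ k b≤a)) (sym (∸-+-∸ b≤a a≤k)))

  tuple-in-C[] : ∀ A Xs → allB (C[ A ]) (toList Xs) ≡ (inC Xs ∧ E._⊆ᵇ_ F n A (suppSum F Xs ^⊥))
  tuple-in-C[] A Xs = trans (allB-∧ C (suppIn (A ^⊥)) (toList Xs)) (cong (inC Xs ∧_) (begin
    allB (suppIn (A ^⊥)) (toList Xs)
      ≡⟨ sym (suppSum-⊆ᵇ Xs (A ^⊥) (^⊥-IsSubspace A)) ⟩
    E._⊆ᵇ_ F n (suppSum F Xs) (A ^⊥)
      ≡⟨ T-ext (^⊥-galois (suppSum F Xs) A) (^⊥-galois A (suppSum F Xs)) ⟩
    E._⊆ᵇ_ F n A (suppSum F Xs ^⊥) ∎))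
    where open ≡-Reasoning

  q^t^dimM≡#tuples : ∀ A → (+ (q ℕ.^ t)) ℤ.^ dimM (C[ A ])
                           ≡ + count (λ Xs → inC Xs ∧ E._⊆ᵇ_ F n A (suppSum F Xs ^⊥)) tuples
  q^t^dimM≡#tuples A = trans (+-^ (q ℕ.^ t) b) (cong +_ (begin
    (q ℕ.^ t) ℕ.^ b
      ≡⟨ ℕP.^-*-assoc q t b ⟩
    q ℕ.^ (t ℕ.* b)
      ≡⟨ cong (q ℕ.^_) (ℕP.*-comm t b) ⟩
    q ℕ.^ (b ℕ.* t)
      ≡⟨ sym (ℕP.^-*-assoc q b t) ⟩
    (q ℕ.^ b) ℕ.^ t
      ≡⟨ cong (ℕ._^ t) (sym (∣C[]∣≡q^dimM A)) ⟩
    SubM.∣ C[ A ] ∣ ℕ.^ t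
      ≡⟨ sym (count-allVecsOf (C[ A ]) (allMats F n m) t) ⟩
    count (λ Xs → allB (C[ A ]) (toList Xs)) tuples
      ≡⟨ ℕ∑.∑-cong tuples (λ Xs → cong ℕ∑.[_] (tuple-in-C[] A Xs)) ⟩
    count (λ Xs → inC Xs ∧ E._⊆ᵇ_ F n A (suppSum F Xs ^⊥)) tuples ∎))
    where
    open ≡-Reasoning
    b = dimM (C[ A ])

  ∑μ-tuple : ∀ Xs → ℤ∑.∑ (λ A → if between (whole F n) A
                                 then μX A ℤ.* ℤ∑.[ inC Xs ∧ E._⊆ᵇ_ F n A (suppSum F Xs ^⊥) ] else + 0) allSubsets
                    ≡ ℤ∑.[ inC Xs ∧ E._≗ᵇ_ F n (suppSum F Xs) U ]
  ∑μ-tuple Xs = begin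
    ℤ∑.∑ (λ A → if between (whole F n) A then μX A ℤ.* ℤ∑.[ inC Xs ∧ A ⊆ᵇ S ^⊥ ] else + 0) allSubsets
      ≡⟨ ℤ∑.∑-cong allSubsets regroup ⟩
    ℤ∑.∑ (λ A → if inC Xs then (if between (S ^⊥) A then μX A else + 0) else + 0) allSubsets
      ≡⟨ ℤ∑.∑-if (inC Xs) _ allSubsets ⟩
    (if inC Xs then ∑μ (S ^⊥) else + 0)
      ≡⟨ cong (λ z → if inC Xs then z else + 0) (∑μ≡δ _ (S ^⊥) (^⊥-IsSubspace S) refl) ⟩
    (if inC Xs then (if (U ^⊥ ⊆ᵇ S ^⊥) ∧ (S ^⊥ ⊆ᵇ U ^⊥) then + 1 else + 0) else + 0)
      ≡⟨ cong (λ b → if inC Xs then (if b then + 1 else + 0) else + 0)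
              (cong₂ _∧_ (^⊥-⊆ᵇ-^⊥ S U sU) (^⊥-⊆ᵇ-^⊥ U S (suppSum-IsSubspace Xs))) ⟩
    (if inC Xs then (if (S ⊆ᵇ U) ∧ (U ⊆ᵇ S) then + 1 else + 0) else + 0)
      ≡⟨ ℤ∑.if-if≡if-∧ (inC Xs) _ (+ 1) ⟩
    ℤ∑.[ inC Xs ∧ (S ≗ᵇ U) ] ∎
    where
    open ≡-Reasoning
    S = suppSum F Xs
    regroup : ∀ A → (if between (whole F n) A then μX A ℤ.* ℤ∑.[ inC Xs ∧ A ⊆ᵇ S ^⊥ ] else + 0)
                    ≡ (if inC Xs then (if between (S ^⊥) A then μX A else + 0) else + 0)
    regroup A rewrite T⇒≡true (SubE.⊆ᵇ⁺ A (whole F n) (λ _ _ → tt))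
      with isSubspace A | U ^⊥ ⊆ᵇ A | inC Xs | A ⊆ᵇ S ^⊥
    ... | true | true | true | true = ℤP.*-identityʳ (μX A)
    ... | true | true | true | false = ℤP.*-zeroʳ (μX A)
    ... | true | true | false | _ = ℤP.*-zeroʳ (μX A)
    ... | true | false | true | _ = refl
    ... | true | false | false | _ = refl
    ... | false | _ | true | _ = refl
    ... | false | _ | false | _ = refl

  μ≡μX : ∀ A → T (E._⊆ᵇ_ F n (U ^⊥) A) → μ (U ^⊥) A ≡ μX A
  μ≡μX A U^⊥⊆A rewrite T⇒≡true U^⊥⊆A = refl

  #tuples≡charPoly : + countB (λ Xs → inC Xs ∧ E._≗ᵇ_ F n (suppSum F Xs) U) tuples ≡ charPolyContr U (+ (q ℕ.^ t))
  #tuples≡charPoly = sym (begin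
    charPolyContr U (+ (q ℕ.^ t))
      ≡⟨ sumℤ≡∑ _ allSubsets ⟩
    ℤ∑.∑ (λ A → if between (whole F n) A
                then μ (U ^⊥) A ℤ.* ((+ (q ℕ.^ t)) ℤ.^ (ρ[ U ^⊥ ] (whole F n) ∸ ρ[ U ^⊥ ] A))
                else + 0) allSubsets
      ≡⟨ ℤ∑.∑-cong allSubsets count-terms ⟩
    ℤ∑.∑ (λ A → ℤ∑.∑ (λ Xs → if between (whole F n) A then μX A ℤ.* ℤ∑.[ P A Xs ] else + 0) tuples) allSubsets
      ≡⟨ ℤ∑.∑-swap _ allSubsets tuples ⟩
    ℤ∑.∑ (λ Xs → ℤ∑.∑ (λ A → if between (whole F n) A then μX A ℤ.* ℤ∑.[ P A Xs ] else + 0) allSubsets) tuples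
      ≡⟨ ℤ∑.∑-cong tuples ∑μ-tuple ⟩
    ℤ∑.∑ (λ Xs → ℤ∑.[ inC Xs ∧ E._≗ᵇ_ F n (suppSum F Xs) U ]) tuples
      ≡⟨ trans (ℤ∑.∑-cong tuples (λ Xs → sym (+-[] _))) (sym (+-∑ _ tuples)) ⟩
    + count (λ Xs → inC Xs ∧ E._≗ᵇ_ F n (suppSum F Xs) U) tuples
      ≡⟨ cong +_ (sym (countB≡count _ tuples)) ⟩
    + countB (λ Xs → inC Xs ∧ E._≗ᵇ_ F n (suppSum F Xs) U) tuples ∎)
    where
    open ≡-Reasoning
    P : E.Sub F n → Vec (Mat F n m) t → Bool
    P A Xs = inC Xs ∧ E._⊆ᵇ_ F n A (suppSum F Xs ^⊥)
    count-terms : ∀ A → (if between (whole F n) A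
                         then μ (U ^⊥) A ℤ.* ((+ (q ℕ.^ t)) ℤ.^ (ρ[ U ^⊥ ] (whole F n) ∸ ρ[ U ^⊥ ] A)) else + 0)
                        ≡ ℤ∑.∑ (λ Xs → if between (whole F n) A then μX A ℤ.* ℤ∑.[ P A Xs ] else + 0) tuples
    count-terms A with between (whole F n) A in btw
    ... | false = sym (ℤ∑.∑-zero tuples (λ _ → refl))
    ... | true = begin
      μ (U ^⊥) A ℤ.* ((+ (q ℕ.^ t)) ℤ.^ (ρ[ U ^⊥ ] (whole F n) ∸ ρ[ U ^⊥ ] A))
        ≡⟨ cong₂ ℤ._*_ (μ≡μX A U^⊥⊆A) (cong ((+ (q ℕ.^ t)) ℤ.^_) (exponent≡dimM A U^⊥⊆A)) ⟩
      μX A ℤ.* ((+ (q ℕ.^ t)) ℤ.^ dimM (C[ A ]))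
        ≡⟨ cong (μX A ℤ.*_) (trans (q^t^dimM≡#tuples A)
                                   (trans (+-∑ _ tuples) (ℤ∑.∑-cong tuples (λ Xs → +-[] (P A Xs))))) ⟩
      μX A ℤ.* ℤ∑.∑ (λ Xs → ℤ∑.[ P A Xs ]) tuples
        ≡⟨ sym (ℤ∑.∑-*ˡ (μX A) _ tuples) ⟩
      ℤ∑.∑ (λ Xs → μX A ℤ.* ℤ∑.[ P A Xs ]) tuples ∎
      where U^⊥⊆A = proj₁ (proj₂ (between⁻ (whole F n) A (≡true⇒T btw)))

theorem4p3 :
    (F : FiniteField) (n m k t : ℕ) → 1 ≤ t →
    (C : M.Sub F n m) → T (M.isSubspace F n m C) → M.HasDim F n m C k →
    (dimE : E.Sub F n → ℕ) →
      (∀ W → T (E.isSubspace F n W) → E.HasDim F n W (dimE W)) →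
    (dimM : M.Sub F n m → ℕ) →
      (∀ S → T (M.isSubspace F n m S) → M.HasDim F n m S (dimM S)) →
    (U : E.Sub F n) → T (E.isSubspace F n U) →
    + countB (λ Xs → allB C (toList Xs) ∧ E._≗ᵇ_ F n (suppSum F Xs) U)
             (allVecsOf (allMats F n m) t)
      ≡ QMatroid.charPolyContr F {n} {m} {k} C dimE dimM U
          (+ (FiniteField.order F ℕ.^ t))
theorem4p3 F n m k t _ C C-isSubspace C-dim dimE dimE-spec dimM dimM-spec U U-isSubspace =
  Contraction.#tuples≡charPoly F n m k t C C-isSubspace C-dim dimE dimE-spec dimM dimM-spec U U-isSubspace
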